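{- For every $m\ge1$, in $\mathbb{Q}[[q]][[X_1,X_2,Y_1,Y_2]]$ (with the difference quotient understood as a power series), $$L_m[X_1\mid Y_1]\,L_m[X_2\mid Y_2]=\frac{L_m[X_1\mid Y_1+Y_2]-L_m[X_2\mid Y_1+Y_2]}{X_1-X_2}+\Big(2\beta(X_2-X_1)-\tfrac12\Big)L_m[X_1\mid Y_1+Y_2]+\Big(2\beta(X_1-X_2)-\tfrac12\Big)L_m[X_2\mid Y_1+Y_2],$$ where $\beta(X)=-\sum_{k\ge2}\frac{B_k}{2\,k!}X^{k-1}$.
   Context: $L_m[X\mid Y]=\frac{e^{X+mY}q^m}{1-e^Xq^m}\in\mathbb{Q}[[q]][[X,Y]]$; $B_k$ are the Bernoulli numbers, $\sum_{n\ge0}B_n\frac{x^n}{n!}=\frac{x}{e^x-1}$. -}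

module Defs where

open import Data.Bool using (Bool; true; false; if_then_else_)
open import Data.Nat as ℕ using (ℕ; zero; suc; _∸_; _≡ᵇ_; _!)
open import Data.Nat.Properties using (_!≢0)
open import Data.Integer using (+_)
open import Data.Rational using (ℚ; 0ℚ; 1ℚ; ½; _+_; _*_; -_; _-_; _/_)
open import Data.List using (List; []; _∷_; zipWith; upTo; map; foldr)
open import Relation.Binary.PropositionalEquality using (_≡_)

-- A series is its coefficient function:
--   F j a b c d = coefficient of q^j X₁^a X₂^b Y₁^c Y₂^d.
-- (ℚ[[q]][[X₁,X₂,Y₁,Y₂]] ≅ ℚ[[q,X₁,X₂,Y₁,Y₂]] as rings.)

Series : Set
Series = ℕ → ℕ → ℕ → ℕ → ℕ → ℚ

infix 4 _≈ₛ_
_≈ₛ_ : Series → Series → Set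
F ≈ₛ G = ∀ j a b c d → F j a b c d ≡ G j a b c d

Σ≤ : ℕ → (ℕ → ℚ) → ℚ
Σ≤ zero    f = f 0
Σ≤ (suc n) f = Σ≤ n f + f (suc n)

ind : Bool → ℚ
ind true  = 1ℚ
ind false = 0ℚ

isZero : ℕ → Bool
isZero zero    = true
isZero (suc _) = false

2ℚ : ℚ
2ℚ = + 2 / 1

ℕ→ℚ : ℕ → ℚ
ℕ→ℚ n = + n / 1

inv! : ℕ → ℚ
inv! n = (+ 1 / (n !)) {{n !≢0}}

infixl 6 _⊕_ _⊖_
infixl 7 _⊛_

_⊕_ : Series → Series → Series
(F ⊕ G) j a b c d = F j a b c d + G j a b c d

⊝_ : Series → Series
(⊝ F) j a b c d = - F j a b c d

_⊖_ : Series → Series → Series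
F ⊖ G = F ⊕ (⊝ G)

_·ₛ_ : ℚ → Series → Series
(r ·ₛ F) j a b c d = r * F j a b c d

_⊛_ : Series → Series → Series
(F ⊛ G) j a b c d =
  Σ≤ j λ j₁ → Σ≤ a λ a₁ → Σ≤ b λ b₁ → Σ≤ c λ c₁ → Σ≤ d λ d₁ →
    F j₁ a₁ b₁ c₁ d₁ * G (j ∸ j₁) (a ∸ a₁) (b ∸ b₁) (c ∸ c₁) (d ∸ d₁)

constₛ : ℚ → Series
constₛ r j a b c d = r * ind (isZero j) * ind (isZero a) * ind (isZero b)
                       * ind (isZero c) * ind (isZero d)

oneₛ : Series
oneₛ = constₛ 1ℚ

_^ₛ_ : Series → ℕ → Series
F ^ₛ zero  = oneₛ
F ^ₛ suc n = F ⊛ (F ^ₛ n)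

qᵛ X₁ X₂ Y₁ Y₂ : Series
qᵛ j a b c d = ind (j ≡ᵇ 1) * ind (isZero a) * ind (isZero b) * ind (isZero c) * ind (isZero d)
X₁ j a b c d = ind (isZero j) * ind (a ≡ᵇ 1) * ind (isZero b) * ind (isZero c) * ind (isZero d)
X₂ j a b c d = ind (isZero j) * ind (isZero a) * ind (b ≡ᵇ 1) * ind (isZero c) * ind (isZero d)
Y₁ j a b c d = ind (isZero j) * ind (isZero a) * ind (isZero b) * ind (c ≡ᵇ 1) * ind (isZero d)
Y₂ j a b c d = ind (isZero j) * ind (isZero a) * ind (isZero b) * ind (isZero c) * ind (d ≡ᵇ 1)

-- Since every monomial of Fⁿ has total
-- degree ≥ n, the coefficient at a monomial of total degree N only
-- receives contributions from n ≤ N, so the finite sum below is exact.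
-- (Only meaningful when F has zero constant term.)

subst₁ : (ℕ → ℚ) → Series → Series
subst₁ c F j a b c′ d =
  Σ≤ (j ℕ.+ a ℕ.+ b ℕ.+ c′ ℕ.+ d) λ n → c n * (F ^ₛ n) j a b c′ d

expₛ : Series → Series
expₛ F = subst₁ inv! F

inv1-ₛ : Series → Series
inv1-ₛ U = subst₁ (λ _ → 1ℚ) U

-- If H = (X₁ - X₂) G then comparing
-- coefficients gives  G(a,b) = Σ_{i=0}^{b} H(a+1+i, b-i)  (the unique
-- solution); this is the difference quotient as a power series.

divX₁-X₂ : Series → Series
divX₁-X₂ H j a b c d = Σ≤ b λ i → H j (a ℕ.+ 1 ℕ.+ i) (b ∸ i) c d

-- Bernoulli numbers via Σ Bₙ xⁿ/n! = x/(eˣ-1).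
-- Write x/(eˣ-1) = 1 / A(x), A(x) = (eˣ-1)/x = Σ_{j≥0} x^j/(j+1)!.
-- bₙ = coefficient of xⁿ in 1/A(x): b₀ = 1, bₙ = -Σ_{k<n} b_k a_{n-k}.
-- bl n = [bₙ, bₙ₋₁, …, b₀].

aCoef : ℕ → ℚ
aCoef j = inv! (suc j)

sumℚ : List ℚ → ℚ
sumℚ = foldr _+_ 0ℚ

hd : List ℚ → ℚ
hd []      = 0ℚ
hd (x ∷ _) = x

bl : ℕ → List ℚ
bl zero    = 1ℚ ∷ []
bl (suc n) = (- sumℚ (zipWith _*_ (bl n) (map (λ i → aCoef (suc i)) (upTo (suc n))))) ∷ bl n

B : ℕ → ℚ
B n = ℕ→ℚ (n !) * hd (bl n)

-- β(X) = - Σ_{k≥2} B_k / (2 k!) X^{k-1}:  coefficient of Xⁿ (n = k-1)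
βCoef : ℕ → ℚ
βCoef zero    = 0ℚ
βCoef (suc n) = - (½ * B (suc (suc n)) * inv! (suc (suc n)))   -- k = n + 2

βₛ : Series → Series
βₛ F = subst₁ βCoef F

L : ℕ → Series → Series → Series
L m X Y = (qᵛ ^ₛ m) ⊛ expₛ (X ⊕ (ℕ→ℚ m ·ₛ Y)) ⊛ inv1-ₛ ((qᵛ ^ₛ m) ⊛ expₛ X)

-- Write u = qᵐ, Eᵢ = e^{Xᵢ} and W = e^{m(Y₁+Y₂)}, so that L_m[Xᵢ|Y₁+Y₂] = u Eᵢ W / (1 - u Eᵢ).
-- With t = X₁ - X₂ one has E₁ = E₂ eᵗ and eᵗ = 1 + t A(t), where A(t) = (eᵗ - 1)/t is inverse to the
-- Bernoulli series T(t) = t/(eᵗ - 1), and t·2β(t) = 1 - t/2 - T(t).  Hence the numerator of the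
-- difference quotient is t times an explicit series, and β(t) + β(-t) = 0; modulo these relations
-- both sides of the identity are the same polynomial.  The power-series input is that substituting a
-- series without constant term into univariate series is multiplicative, which yields e^{F+G} = e^F e^G
-- and the Bernoulli relations.

module Submission where

open import Defs
open import Data.Nat as ℕ using (ℕ; zero; suc; _∸_; _≤_; _<_; z≤n; s≤s)
import Data.Nat.Properties as ℕₚ
open import Data.Rational using (½)
open import Data.Product using (_,_)
open import Data.Sum using (inj₁; inj₂)
open import Data.Empty using (⊥-elim)
open import Relation.Nullary using (yes; no)
open import Relation.Binary.PropositionalEquality as ≡ using (_≡_; _≢_)
open import Algebra.Bundles using (CommutativeRing)
import Algebra.Construct.Pointwise as Pointwise

module FiniteSum {c ℓ} (R : CommutativeRing c ℓ) where

  open CommutativeRing R hiding (zero)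
  open import Relation.Binary.Reasoning.Setoid setoid
  open import Algebra.Properties.AbelianGroup +-abelianGroup using (⁻¹-∙-comm)

  Σ : ℕ → (ℕ → Carrier) → Carrier
  Σ zero    f = f 0
  Σ (suc n) f = Σ n f + f (suc n)

  Σ-cong-≤ : ∀ n {f g} → (∀ i → i ≤ n → f i ≈ g i) → Σ n f ≈ Σ n g
  Σ-cong-≤ zero    f≈g = f≈g 0 z≤n
  Σ-cong-≤ (suc n) f≈g = +-cong (Σ-cong-≤ n (λ i i≤n → f≈g i (ℕₚ.m≤n⇒m≤1+n i≤n))) (f≈g (suc n) ℕₚ.≤-refl)

  Σ-cong : ∀ n {f g} → (∀ i → f i ≈ g i) → Σ n f ≈ Σ n g
  Σ-cong n f≈g = Σ-cong-≤ n (λ i _ → f≈g i)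

  Σ-zero : ∀ n {f} → (∀ i → i ≤ n → f i ≈ 0#) → Σ n f ≈ 0#
  Σ-zero zero    f≈0 = f≈0 0 z≤n
  Σ-zero (suc n) f≈0 =
    trans (+-cong (Σ-zero n (λ i i≤n → f≈0 i (ℕₚ.m≤n⇒m≤1+n i≤n))) (f≈0 (suc n) ℕₚ.≤-refl)) (+-identityˡ 0#)

  Σ-distrib-+ : ∀ n f g → Σ n (λ i → f i + g i) ≈ Σ n f + Σ n g
  Σ-distrib-+ zero    f g = refl
  Σ-distrib-+ (suc n) f g = begin
    Σ n (λ i → f i + g i) + (f (suc n) + g (suc n)) ≈⟨ +-congʳ (Σ-distrib-+ n f g) ⟩
    (Σ n f + Σ n g) + (f (suc n) + g (suc n))       ≈⟨ interchange _ _ _ _ ⟩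
    (Σ n f + f (suc n)) + (Σ n g + g (suc n))       ∎
    where open import Algebra.Properties.CommutativeSemigroup +-commutativeSemigroup using (interchange)

  Σ-*ˡ : ∀ n x f → Σ n (λ i → x * f i) ≈ x * Σ n f
  Σ-*ˡ zero    x f = refl
  Σ-*ˡ (suc n) x f = trans (+-congʳ (Σ-*ˡ n x f)) (sym (distribˡ x (Σ n f) (f (suc n))))

  Σ-*ʳ : ∀ n x f → Σ n (λ i → f i * x) ≈ Σ n f * x
  Σ-*ʳ zero    x f = refl
  Σ-*ʳ (suc n) x f = trans (+-congʳ (Σ-*ʳ n x f)) (sym (distribʳ x (Σ n f) (f (suc n))))

  Σ-neg : ∀ n f → Σ n (λ i → - f i) ≈ - Σ n f
  Σ-neg zero    f = refl
  Σ-neg (suc n) f = trans (+-congʳ (Σ-neg n f)) (⁻¹-∙-comm (Σ n f) (f (suc n)))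

  Σ-unfoldˡ : ∀ n f → Σ (suc n) f ≈ f 0 + Σ n (λ i → f (suc i))
  Σ-unfoldˡ zero    f = refl
  Σ-unfoldˡ (suc n) f = trans (+-congʳ (Σ-unfoldˡ n f)) (+-assoc _ _ _)

  Σ-single : ∀ n k {f} → k ≤ n → (∀ i → i ≤ n → i ≢ k → f i ≈ 0#) → Σ n f ≈ f k
  Σ-single zero    .zero z≤n f≈0 = refl
  Σ-single (suc n) k     k≤1+n f≈0 with k ℕ.≟ suc n
  ... | yes ≡.refl = trans (+-congʳ (Σ-zero n (λ i i≤n → f≈0 i (ℕₚ.m≤n⇒m≤1+n i≤n) (ℕₚ.<⇒≢ (s≤s i≤n)))))
                           (+-identityˡ _)
  ... | no  k≢1+n  = trans (+-cong (Σ-single n k (ℕₚ.≤-pred (ℕₚ.≤∧≢⇒< k≤1+n k≢1+n))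
                                     (λ i i≤n → f≈0 i (ℕₚ.m≤n⇒m≤1+n i≤n)))
                                   (f≈0 (suc n) ℕₚ.≤-refl (k≢1+n ∘ ≡.sym)))
                           (+-identityʳ _)
    where open import Function using (_∘_)

  Σ-extend : ∀ {n} M {f} → n ≤ M → (∀ i → n < i → i ≤ M → f i ≈ 0#) → Σ M f ≈ Σ n f
  Σ-extend M n≤M f≈0 with ℕₚ.m≤n⇒m<n∨m≡n n≤M
  Σ-extend M       n≤M f≈0 | inj₂ ≡.refl      = refl
  Σ-extend (suc M) n≤M f≈0 | inj₁ (s≤s n≤M′) =
    trans (+-cong (Σ-extend M n≤M′ (λ i n<i i≤M → f≈0 i n<i (ℕₚ.m≤n⇒m≤1+n i≤M)))
                  (f≈0 (suc M) (s≤s n≤M′) ℕₚ.≤-refl))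
          (+-identityʳ _)

  Σ-reverse : ∀ n f → Σ n f ≈ Σ n (λ i → f (n ∸ i))
  Σ-reverse zero    f = refl
  Σ-reverse (suc n) f = begin
    Σ n f + f (suc n)                  ≈⟨ +-comm _ _ ⟩
    f (suc n) + Σ n f                  ≈⟨ +-congˡ (Σ-reverse n f) ⟩
    f (suc n) + Σ n (λ i → f (n ∸ i))  ≈⟨ Σ-unfoldˡ n (λ i → f (suc n ∸ i)) ⟨
    Σ (suc n) (λ i → f (suc n ∸ i))    ∎

  Σ-triangle : ∀ n (g : ℕ → ℕ → Carrier) →
               Σ n (λ N → Σ N (λ i → g i (N ∸ i))) ≈ Σ n (λ i → Σ (n ∸ i) (g i))
  Σ-triangle zero    g = refl
  Σ-triangle (suc n) g = begin
    Σ n (λ N → Σ N (λ i → g i (N ∸ i))) + (Σ n (λ i → g i (suc n ∸ i)) + g (suc n) (n ∸ n))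
      ≈⟨ +-congʳ (Σ-triangle n g) ⟩
    Σ n (λ i → Σ (n ∸ i) (g i)) + (Σ n (λ i → g i (suc n ∸ i)) + g (suc n) (n ∸ n))
      ≈⟨ +-assoc _ _ _ ⟨
    (Σ n (λ i → Σ (n ∸ i) (g i)) + Σ n (λ i → g i (suc n ∸ i))) + g (suc n) (n ∸ n)
      ≈⟨ +-congʳ (Σ-distrib-+ n _ _) ⟨
    Σ n (λ i → Σ (n ∸ i) (g i) + g i (suc n ∸ i)) + g (suc n) (n ∸ n)
      ≈⟨ +-cong (Σ-cong-≤ n widen) lastTerm ⟩
    Σ n (λ i → Σ (suc n ∸ i) (g i)) + Σ (suc n ∸ suc n) (g (suc n))
      ∎
    where
    widen : ∀ i → i ≤ n → Σ (n ∸ i) (g i) + g i (suc n ∸ i) ≈ Σ (suc n ∸ i) (g i)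
    widen i i≤n rewrite ℕₚ.+-∸-assoc 1 i≤n = refl
    lastTerm : g (suc n) (n ∸ n) ≈ Σ (n ∸ n) (g (suc n))
    lastTerm rewrite ℕₚ.n∸n≡0 n = refl

module PowerSeries {c ℓ} (R : CommutativeRing c ℓ) where

  open CommutativeRing R hiding (zero)
  open import Relation.Binary.Reasoning.Setoid setoid
  open FiniteSum R

  infix  4 _≈ₚ_
  infixl 7 _*ₚ_

  R⟦x⟧ : Set c
  R⟦x⟧ = ℕ → Carrier

  _≈ₚ_ : R⟦x⟧ → R⟦x⟧ → Set ℓ
  f ≈ₚ g = ∀ n → f n ≈ g n

  _*ₚ_ : R⟦x⟧ → R⟦x⟧ → R⟦x⟧
  (f *ₚ g) n = Σ n (λ i → f i * g (n ∸ i))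

  C : Carrier → R⟦x⟧
  C r zero    = r
  C r (suc _) = 0#

  x : R⟦x⟧
  x 1 = 1#
  x _ = 0#

  C-*ₚ : ∀ r g n → (C r *ₚ g) n ≈ r * g n
  C-*ₚ r g n = Σ-single n 0 z≤n vanish
    where
    vanish : ∀ i → i ≤ n → i ≢ 0 → C r i * g (n ∸ i) ≈ 0#
    vanish zero    _ 0≢0 = ⊥-elim (0≢0 ≡.refl)
    vanish (suc i) _ _   = zeroˡ _

  x-*ₚ-zero : ∀ g → (x *ₚ g) 0 ≈ 0#
  x-*ₚ-zero g = zeroˡ (g 0)

  x-*ₚ-suc : ∀ g n → (x *ₚ g) (suc n) ≈ g n
  x-*ₚ-suc g n = trans (Σ-single (suc n) 1 (s≤s z≤n) vanish) (*-identityˡ (g n))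
    where
    vanish : ∀ i → i ≤ suc n → i ≢ 1 → x i * g (suc n ∸ i) ≈ 0#
    vanish zero          _ _   = zeroˡ _
    vanish (suc zero)    _ 1≢1 = ⊥-elim (1≢1 ≡.refl)
    vanish (suc (suc i)) _ _   = zeroˡ _

  *ₚ-cong : ∀ {f f′ g g′} → f ≈ₚ f′ → g ≈ₚ g′ → f *ₚ g ≈ₚ f′ *ₚ g′
  *ₚ-cong f≈f′ g≈g′ n = Σ-cong n (λ i → *-cong (f≈f′ i) (g≈g′ (n ∸ i)))

  *ₚ-comm : ∀ f g → f *ₚ g ≈ₚ g *ₚ f
  *ₚ-comm f g n = trans (Σ-reverse n _) (Σ-cong-≤ n reindex)
    where
    reindex : ∀ i → i ≤ n → f (n ∸ i) * g (n ∸ (n ∸ i)) ≈ g i * f (n ∸ i)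
    reindex i i≤n rewrite ℕₚ.m∸[m∸n]≡n i≤n = *-comm _ _

  *ₚ-identityˡ : ∀ g → C 1# *ₚ g ≈ₚ g
  *ₚ-identityˡ g n = trans (C-*ₚ 1# g n) (*-identityˡ (g n))

  *ₚ-distribˡ : ∀ f g h → f *ₚ (λ n → g n + h n) ≈ₚ (λ n → (f *ₚ g) n + (f *ₚ h) n)
  *ₚ-distribˡ f g h n = trans (Σ-cong n (λ i → distribˡ _ _ _)) (Σ-distrib-+ n _ _)

  *ₚ-assoc : ∀ f g h → (f *ₚ g) *ₚ h ≈ₚ f *ₚ (g *ₚ h)
  *ₚ-assoc f g h n = begin
    Σ n (λ N → Σ N (λ i → f i * g (N ∸ i)) * h (n ∸ N))
      ≈⟨ Σ-cong n (λ N → sym (Σ-*ʳ N _ _)) ⟩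
    Σ n (λ N → Σ N (λ i → (f i * g (N ∸ i)) * h (n ∸ N)))
      ≈⟨ Σ-cong n (λ N → Σ-cong-≤ N (λ i i≤N → trans (*-assoc _ _ _) (regroup N i i≤N))) ⟩
    Σ n (λ N → Σ N (λ i → term i (N ∸ i)))
      ≈⟨ Σ-triangle n term ⟩
    Σ n (λ i → Σ (n ∸ i) (term i))
      ≈⟨ Σ-cong n (λ i → trans (Σ-cong (n ∸ i) (λ k → *-congˡ (*-congˡ (reflexive
           (≡.cong h (≡.sym (ℕₚ.∸-+-assoc n i k))))))) (Σ-*ˡ (n ∸ i) (f i) _)) ⟩
    Σ n (λ i → f i * Σ (n ∸ i) (λ k → g k * h (n ∸ i ∸ k)))
      ∎
    where
    term : ℕ → ℕ → Carrier
    term i k = f i * (g k * h (n ∸ (i ℕ.+ k)))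
    regroup : ∀ N i → i ≤ N → f i * (g (N ∸ i) * h (n ∸ N)) ≈ term i (N ∸ i)
    regroup N i i≤N rewrite ℕₚ.m+[n∸m]≡n i≤N = refl

  *ₚ-identityʳ : ∀ g → g *ₚ C 1# ≈ₚ g
  *ₚ-identityʳ g n = trans (*ₚ-comm g (C 1#) n) (*ₚ-identityˡ g n)

  *ₚ-distribʳ : ∀ f g h → (λ n → g n + h n) *ₚ f ≈ₚ (λ n → (g *ₚ f) n + (h *ₚ f) n)
  *ₚ-distribʳ f g h n =
    trans (*ₚ-comm _ f n) (trans (*ₚ-distribˡ f g h n) (+-cong (*ₚ-comm f g n) (*ₚ-comm f h n)))

  commutativeRing : CommutativeRing c ℓ
  commutativeRing = record
    { Carrier           = R⟦x⟧
    ; _≈_               = _≈ₚ_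
    ; _*_               = _*ₚ_
    ; 1#                = C 1#
    ; isCommutativeRing = record
      { isRing = record
        { +-isAbelianGroup = Pointwise.isAbelianGroup ℕ +-isAbelianGroup
        ; *-cong           = *ₚ-cong
        ; *-assoc          = *ₚ-assoc
        ; *-identity       = *ₚ-identityˡ , *ₚ-identityʳ
        ; distrib          = *ₚ-distribˡ , *ₚ-distribʳ
        }
      ; *-comm = *ₚ-comm
      }
    }

  Σ-pointwise : ∀ n (F : ℕ → R⟦x⟧) k → FiniteSum.Σ commutativeRing n F k ≈ Σ n (λ i → F i k)
  Σ-pointwise zero    F k = refl
  Σ-pointwise (suc n) F k = +-congʳ (Σ-pointwise n F k)

-- Series = ℚ[[Y₂]][[Y₁]][[X₂]][[X₁]][[q]]: the ring of series is built by iterating R ↦ R[[x]],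
-- the first coefficient index being the outermost variable q.
module SeriesRing where

  open import Data.Bool using (true; false; _∧_)
  open import Data.Rational as ℚ using (0ℚ)
  import Data.Rational.Properties as ℚₚ

  R₀ R₁ R₂ R₃ R₄ R₅ : CommutativeRing _ _
  R₀ = ℚₚ.+-*-commutativeRing
  R₁ = PowerSeries.commutativeRing R₀
  R₂ = PowerSeries.commutativeRing R₁
  R₃ = PowerSeries.commutativeRing R₂
  R₄ = PowerSeries.commutativeRing R₃
  R₅ = PowerSeries.commutativeRing R₄

  module P₂ = PowerSeries R₂
  module P₃ = PowerSeries R₃
  module P₄ = PowerSeries R₄
  module R₅ = CommutativeRing R₅

  Σ≡Σ≤ : ∀ n f → FiniteSum.Σ R₀ n f ≡ Σ≤ n f
  Σ≡Σ≤ zero    f = ≡.refl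
  Σ≡Σ≤ (suc n) f = ≡.cong (ℚ._+ f (suc n)) (Σ≡Σ≤ n f)

  Σ≤-cong : ∀ n {f g} → (∀ i → f i ≡ g i) → Σ≤ n f ≡ Σ≤ n g
  Σ≤-cong zero    f≡g = f≡g 0
  Σ≤-cong (suc n) f≡g = ≡.cong₂ ℚ._+_ (Σ≤-cong n f≡g) (f≡g (suc n))

  ⊛≈* : ∀ F G → F ⊛ G ≈ₛ F R₅.* G
  ⊛≈* F G j a b c d = ≡.sym (≡.trans (Σ-unfold₄ j _ a b c d) (Σ≤-cong j (λ j₁ → *-unfold₄ (F j₁) (G (j ∸ j₁)) a b c d)))
    where
    open CommutativeRing R₄ using () renaming (_*_ to _*₄_)
    open CommutativeRing R₃ using () renaming (_*_ to _*₃_)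
    open CommutativeRing R₂ using () renaming (_*_ to _*₂_)
    open CommutativeRing R₁ using () renaming (_*_ to _*₁_)
    Σ-unfold₁ : ∀ n F d → FiniteSum.Σ R₁ n F d ≡ Σ≤ n (λ i → F i d)
    Σ-unfold₁ n F d = ≡.trans (PowerSeries.Σ-pointwise R₀ n F d) (Σ≡Σ≤ n _)
    Σ-unfold₂ : ∀ n F c d → FiniteSum.Σ R₂ n F c d ≡ Σ≤ n (λ i → F i c d)
    Σ-unfold₂ n F c d = ≡.trans (PowerSeries.Σ-pointwise R₁ n F c d) (Σ-unfold₁ n (λ i → F i c) d)
    Σ-unfold₃ : ∀ n F b c d → FiniteSum.Σ R₃ n F b c d ≡ Σ≤ n (λ i → F i b c d)
    Σ-unfold₃ n F b c d = ≡.trans (P₂.Σ-pointwise n F b c d) (Σ-unfold₂ n (λ i → F i b) c d)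
    Σ-unfold₄ : ∀ n F a b c d → FiniteSum.Σ R₄ n F a b c d ≡ Σ≤ n (λ i → F i a b c d)
    Σ-unfold₄ n F a b c d = ≡.trans (P₃.Σ-pointwise n F a b c d) (Σ-unfold₃ n (λ i → F i a) b c d)
    *-unfold₁ : ∀ f g d → (f *₁ g) d ≡ Σ≤ d (λ d₁ → f d₁ ℚ.* g (d ∸ d₁))
    *-unfold₁ f g d = Σ≡Σ≤ d _
    *-unfold₂ : ∀ f g c d → (f *₂ g) c d ≡ Σ≤ c (λ c₁ → Σ≤ d (λ d₁ → f c₁ d₁ ℚ.* g (c ∸ c₁) (d ∸ d₁)))
    *-unfold₂ f g c d = ≡.trans (Σ-unfold₁ c _ d) (Σ≤-cong c (λ c₁ → *-unfold₁ (f c₁) (g (c ∸ c₁)) d))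
    *-unfold₃ : ∀ f g b c d → (f *₃ g) b c d ≡
           Σ≤ b (λ b₁ → Σ≤ c (λ c₁ → Σ≤ d (λ d₁ → f b₁ c₁ d₁ ℚ.* g (b ∸ b₁) (c ∸ c₁) (d ∸ d₁))))
    *-unfold₃ f g b c d = ≡.trans (Σ-unfold₂ b _ c d) (Σ≤-cong b (λ b₁ → *-unfold₂ (f b₁) (g (b ∸ b₁)) c d))
    *-unfold₄ : ∀ f g a b c d → (f *₄ g) a b c d ≡
           Σ≤ a (λ a₁ → Σ≤ b (λ b₁ → Σ≤ c (λ c₁ → Σ≤ d (λ d₁ →
             f a₁ b₁ c₁ d₁ ℚ.* g (a ∸ a₁) (b ∸ b₁) (c ∸ c₁) (d ∸ d₁)))))
    *-unfold₄ f g a b c d = ≡.trans (Σ-unfold₃ a _ b c d) (Σ≤-cong a (λ a₁ → *-unfold₃ (f a₁) (g (a ∸ a₁)) b c d))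

  ind-* : ∀ p q → ind p ℚ.* ind q ≡ ind (p ∧ q)
  ind-* true  q = ℚₚ.*-identityˡ (ind q)
  ind-* false q = ℚₚ.*-zeroˡ (ind q)

  ind⁵ : ∀ p q r s t → ind p ℚ.* ind q ℚ.* ind r ℚ.* ind s ℚ.* ind t ≡ ind ((((p ∧ q) ∧ r) ∧ s) ∧ t)
  ind⁵ p q r s t rewrite ind-* p q | ind-* (p ∧ q) r | ind-* ((p ∧ q) ∧ r) s = ind-* (((p ∧ q) ∧ r) ∧ s) t

  oneₛ≈1# : oneₛ ≈ₛ R₅.1#
  oneₛ≈1# j a b c d = ≡.trans (≡.cong (λ z → z ℚ.* ind (isZero a) ℚ.* ind (isZero b) ℚ.* ind (isZero c) ℚ.* ind (isZero d))
                                        (ℚₚ.*-identityˡ (ind (isZero j))))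
                        (≡.trans (ind⁵ (isZero j) (isZero a) (isZero b) (isZero c) (isZero d)) (unit j a b c d))
    where
    unit : ∀ j a b c d → ind ((((isZero j ∧ isZero a) ∧ isZero b) ∧ isZero c) ∧ isZero d) ≡ R₅.1# j a b c d
    unit (suc j) a       b       c       d       = ≡.refl
    unit zero    (suc a) b       c       d       = ≡.refl
    unit zero    zero    (suc b) c       d       = ≡.refl
    unit zero    zero    zero    (suc c) d       = ≡.refl
    unit zero    zero    zero    zero    (suc d) = ≡.refl
    unit zero    zero    zero    zero    zero    = ≡.refl

  X₁≈ : X₁ ≈ₛ P₄.C P₃.x
  X₁≈ j a b c d = ≡.trans (ind⁵ (isZero j) (a ℕ.≡ᵇ 1) (isZero b) (isZero c) (isZero d)) (mono j a b c d)
    where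
    mono : ∀ j a b c d → ind ((((isZero j ∧ (a ℕ.≡ᵇ 1)) ∧ isZero b) ∧ isZero c) ∧ isZero d) ≡ P₄.C P₃.x j a b c d
    mono (suc j) a             b       c       d       = ≡.refl
    mono zero    zero          b       c       d       = ≡.refl
    mono zero    (suc (suc a)) b       c       d       = ≡.refl
    mono zero    1             (suc b) c       d       = ≡.refl
    mono zero    1             zero    (suc c) d       = ≡.refl
    mono zero    1             zero    zero    (suc d) = ≡.refl
    mono zero    1             zero    zero    zero    = ≡.refl

  X₂≈ : X₂ ≈ₛ P₄.C (P₃.C P₂.x)
  X₂≈ j a b c d = ≡.trans (ind⁵ (isZero j) (isZero a) (b ℕ.≡ᵇ 1) (isZero c) (isZero d)) (mono j a b c d)
    where
    mono : ∀ j a b c d → ind ((((isZero j ∧ isZero a) ∧ (b ℕ.≡ᵇ 1)) ∧ isZero c) ∧ isZero d) ≡ P₄.C (P₃.C P₂.x) j a b c d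
    mono (suc j) a       b             c       d       = ≡.refl
    mono zero    (suc a) b             c       d       = ≡.refl
    mono zero    zero    zero          c       d       = ≡.refl
    mono zero    zero    (suc (suc b)) c       d       = ≡.refl
    mono zero    zero    1             (suc c) d       = ≡.refl
    mono zero    zero    1             zero    (suc d) = ≡.refl
    mono zero    zero    1             zero    zero    = ≡.refl

  ⊛-cong : ∀ {F F′ G G′} → F ≈ₛ F′ → G ≈ₛ G′ → F ⊛ G ≈ₛ F′ ⊛ G′
  ⊛-cong {F} {F′} {G} {G′} F≈F′ G≈G′ = R₅.trans (⊛≈* F G) (R₅.trans (R₅.*-cong F≈F′ G≈G′) (R₅.sym (⊛≈* F′ G′)))

  commutativeRing : CommutativeRing _ _
  commutativeRing = record
    { Carrier           = Series
    ; _≈_               = _≈ₛ_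
    ; _+_               = _⊕_
    ; _*_               = _⊛_
    ; -_                = ⊝_
    ; 0#                = R₅.0#
    ; 1#                = oneₛ
    ; isCommutativeRing = record
      { isRing = record
        { +-isAbelianGroup = R₅.+-isAbelianGroup
        ; *-cong           = ⊛-cong
        ; *-assoc          = assoc
        ; *-identity       = (λ F → trans (⊛-cong oneₛ≈1# (refl {F})) (trans (⊛≈* R₅.1# F) (R₅.*-identityˡ F)))
                           , (λ F → trans (⊛-cong (refl {F}) oneₛ≈1#) (trans (⊛≈* F R₅.1#) (R₅.*-identityʳ F)))
        ; distrib          = (λ F G H → trans (⊛≈* F (G ⊕ H))
                                          (trans (R₅.distribˡ F G H) (R₅.+-cong (sym (⊛≈* F G)) (sym (⊛≈* F H)))))
                           , (λ F G H → trans (⊛≈* (G ⊕ H) F)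
                                          (trans (R₅.distribʳ F G H) (R₅.+-cong (sym (⊛≈* G F)) (sym (⊛≈* H F)))))
        }
      ; *-comm = λ F G → trans (⊛≈* F G) (trans (R₅.*-comm F G) (sym (⊛≈* G F)))
      }
    }
    where
    open R₅ using (refl; sym; trans)
    open import Relation.Binary.Reasoning.Setoid R₅.setoid
    assoc : ∀ F G H → (F ⊛ G) ⊛ H ≈ₛ F ⊛ (G ⊛ H)
    assoc F G H = begin
      (F ⊛ G) ⊛ H         ≈⟨ ⊛≈* (F ⊛ G) H ⟩
      (F ⊛ G) R₅.* H      ≈⟨ R₅.*-congʳ {H} (⊛≈* F G) ⟩
      (F R₅.* G) R₅.* H   ≈⟨ R₅.*-assoc F G H ⟩
      F R₅.* (G R₅.* H)   ≈⟨ R₅.*-congˡ {F} (⊛≈* G H) ⟨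
      F R₅.* (G ⊛ H)      ≈⟨ ⊛≈* F (G ⊛ H) ⟨
      F ⊛ (G ⊛ H)         ∎

  X₁-⊛-suc : ∀ G j a b c d → (X₁ ⊛ G) j (suc a) b c d ≡ G j a b c d
  X₁-⊛-suc G j a b c d =
    ≡.trans (R₅.trans (⊛-cong X₁≈ (R₅.refl {G})) (⊛≈* (P₄.C P₃.x) G) j (suc a) b c d)
            (≡.trans (P₄.C-*ₚ P₃.x G j (suc a) b c d) (P₃.x-*ₚ-suc (G j) a b c d))

  X₂-⊛-suc : ∀ G j a b c d → (X₂ ⊛ G) j a (suc b) c d ≡ G j a b c d
  X₂-⊛-suc G j a b c d =
    ≡.trans (R₅.trans (⊛-cong X₂≈ (R₅.refl {G})) (⊛≈* (P₄.C (P₃.C P₂.x)) G) j a (suc b) c d)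
            (≡.trans (P₄.C-*ₚ (P₃.C P₂.x) G j a (suc b) c d)
            (≡.trans (P₃.C-*ₚ P₂.x (G j) a (suc b) c d) (P₂.x-*ₚ-suc (G j a) b c d)))

  X₂-⊛-zero : ∀ G j a c d → (X₂ ⊛ G) j a 0 c d ≡ 0ℚ
  X₂-⊛-zero G j a c d =
    ≡.trans (R₅.trans (⊛-cong X₂≈ (R₅.refl {G})) (⊛≈* (P₄.C (P₃.C P₂.x)) G) j a 0 c d)
            (≡.trans (P₄.C-*ₚ (P₃.C P₂.x) G j a 0 c d)
            (≡.trans (P₃.C-*ₚ P₂.x (G j) a 0 c d) (P₂.x-*ₚ-zero (G j a) c d)))

module RationalSums where

  open import Data.Rational using (ℚ; 0ℚ; _+_; _*_; -_; _-_)
  open import Data.Rational.Solver using (module +-*-Solver)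
  open +-*-Solver using (solve; _:=_; _:+_; _:-_)
  open SeriesRing using (R₀; Σ≡Σ≤; Σ≤-cong)
  open FiniteSum R₀

  Σ≤-cong-≤ : ∀ n {f g} → (∀ i → i ≤ n → f i ≡ g i) → Σ≤ n f ≡ Σ≤ n g
  Σ≤-cong-≤ n f≡g = ≡.trans (≡.sym (Σ≡Σ≤ n _)) (≡.trans (Σ-cong-≤ n f≡g) (Σ≡Σ≤ n _))

  Σ≤-zero : ∀ n {f} → (∀ i → i ≤ n → f i ≡ 0ℚ) → Σ≤ n f ≡ 0ℚ
  Σ≤-zero n f≡0 = ≡.trans (≡.sym (Σ≡Σ≤ n _)) (Σ-zero n f≡0)

  Σ≤-single : ∀ n k {f} → k ≤ n → (∀ i → i ≤ n → i ≢ k → f i ≡ 0ℚ) → Σ≤ n f ≡ f k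
  Σ≤-single n k k≤n f≡0 = ≡.trans (≡.sym (Σ≡Σ≤ n _)) (Σ-single n k k≤n f≡0)

  Σ≤-extend : ∀ {n} M {f} → n ≤ M → (∀ i → n < i → i ≤ M → f i ≡ 0ℚ) → Σ≤ M f ≡ Σ≤ n f
  Σ≤-extend {n} M n≤M f≡0 = ≡.trans (≡.sym (Σ≡Σ≤ M _)) (≡.trans (Σ-extend M n≤M f≡0) (Σ≡Σ≤ n _))

  Σ≤-distrib-+ : ∀ n f g → Σ≤ n (λ i → f i + g i) ≡ Σ≤ n f + Σ≤ n g
  Σ≤-distrib-+ n f g =
    ≡.trans (≡.sym (Σ≡Σ≤ n _)) (≡.trans (Σ-distrib-+ n f g) (≡.cong₂ _+_ (Σ≡Σ≤ n f) (Σ≡Σ≤ n g)))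

  Σ≤-*ˡ : ∀ n x f → Σ≤ n (λ i → x * f i) ≡ x * Σ≤ n f
  Σ≤-*ˡ n x f = ≡.trans (≡.sym (Σ≡Σ≤ n _)) (≡.trans (Σ-*ˡ n x f) (≡.cong (x *_) (Σ≡Σ≤ n f)))

  Σ≤-*ʳ : ∀ n x f → Σ≤ n (λ i → f i * x) ≡ Σ≤ n f * x
  Σ≤-*ʳ n x f = ≡.trans (≡.sym (Σ≡Σ≤ n _)) (≡.trans (Σ-*ʳ n x f) (≡.cong (_* x) (Σ≡Σ≤ n f)))

  Σ≤-neg : ∀ n f → Σ≤ n (λ i → - f i) ≡ - Σ≤ n f
  Σ≤-neg n f = ≡.trans (≡.sym (Σ≡Σ≤ n _)) (≡.trans (Σ-neg n f) (≡.cong -_ (Σ≡Σ≤ n f)))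

  Σ≤-unfoldˡ : ∀ n f → Σ≤ (suc n) f ≡ f 0 + Σ≤ n (λ i → f (suc i))
  Σ≤-unfoldˡ n f = ≡.trans (≡.sym (Σ≡Σ≤ (suc n) f)) (≡.trans (Σ-unfoldˡ n f) (≡.cong (f 0 +_) (Σ≡Σ≤ n _)))

  Σ≤-triangle : ∀ n (g : ℕ → ℕ → ℚ) →
                Σ≤ n (λ N → Σ≤ N (λ i → g i (N ∸ i))) ≡ Σ≤ n (λ i → Σ≤ (n ∸ i) (g i))
  Σ≤-triangle n g = begin
    Σ≤ n (λ N → Σ≤ N (λ i → g i (N ∸ i))) ≡⟨ Σ≤-cong n (λ N → Σ≡Σ≤ N _) ⟨
    Σ≤ n (λ N → Σ N (λ i → g i (N ∸ i)))  ≡⟨ Σ≡Σ≤ n _ ⟨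
    Σ n (λ N → Σ N (λ i → g i (N ∸ i)))   ≡⟨ Σ-triangle n g ⟩
    Σ n (λ i → Σ (n ∸ i) (g i))           ≡⟨ Σ≡Σ≤ n _ ⟩
    Σ≤ n (λ i → Σ (n ∸ i) (g i))          ≡⟨ Σ≤-cong n (λ i → Σ≡Σ≤ (n ∸ i) (g i)) ⟩
    Σ≤ n (λ i → Σ≤ (n ∸ i) (g i))         ∎
    where open ≡.≡-Reasoning

  Σ≤-telescope : ∀ n (g : ℕ → ℚ) → Σ≤ n (λ i → g i - g (suc i)) ≡ g 0 - g (suc n)
  Σ≤-telescope zero    g = ≡.refl
  Σ≤-telescope (suc n) g =
    ≡.trans (≡.cong (_+ (g (suc n) - g (suc (suc n)))) (Σ≤-telescope n g))
            (solve 3 (λ x y z → (x :- y) :+ (y :- z) := x :- z) ≡.refl (g 0) (g (suc n)) (g (suc (suc n))))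

  Σ≤-telescope-to : ∀ n (g e : ℕ → ℚ) → (∀ i → i < n → e i ≡ g i - g (suc i)) → e n ≡ g n → Σ≤ n e ≡ g 0
  Σ≤-telescope-to zero    g e _     eₙ≡gₙ = eₙ≡gₙ
  Σ≤-telescope-to (suc n) g e eᵢ≡Δg eₙ≡gₙ =
    ≡.trans (≡.cong₂ _+_ (≡.trans (Σ≤-cong-≤ n (λ i i≤n → eᵢ≡Δg i (s≤s i≤n))) (Σ≤-telescope n g)) eₙ≡gₙ)
            (solve 2 (λ x y → (x :- y) :+ y := x) ≡.refl (g 0) (g (suc n)))

module Scalars where

  open import Data.Rational as ℚ using (ℚ; _*_)
  import Data.Rational.Properties as ℚₚ
  open SeriesRing using (Σ≤-cong; commutativeRing)
  open RationalSums
  open CommutativeRing commutativeRing using (*-comm)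
  open FiniteSum commutativeRing using (Σ)

  ·ₛ-⊛ : ∀ r F G → (r ·ₛ F) ⊛ G ≈ₛ r ·ₛ (F ⊛ G)
  ·ₛ-⊛ r F G j a b c d =
    ≡.trans (Σ≤-cong j λ _ → Σ≤-cong a λ _ → Σ≤-cong b λ _ → Σ≤-cong c λ _ →
               ≡.trans (Σ≤-cong d λ _ → ℚₚ.*-assoc r _ _) (Σ≤-*ˡ d r _))
    (≡.trans (Σ≤-cong j λ _ → Σ≤-cong a λ _ → Σ≤-cong b λ _ → Σ≤-*ˡ c r _)
    (≡.trans (Σ≤-cong j λ _ → Σ≤-cong a λ _ → Σ≤-*ˡ b r _)
    (≡.trans (Σ≤-cong j λ _ → Σ≤-*ˡ a r _)
             (Σ≤-*ˡ j r _))))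

  ·ₛ-cong : ∀ r {F G} → F ≈ₛ G → r ·ₛ F ≈ₛ r ·ₛ G
  ·ₛ-cong r F≈G j a b c d = ≡.cong (r *_) (F≈G j a b c d)

  ⊛-·ₛ : ∀ r F G → F ⊛ (r ·ₛ G) ≈ₛ r ·ₛ (F ⊛ G)
  ⊛-·ₛ r F G j a b c d =
    ≡.trans (*-comm F (r ·ₛ G) j a b c d) (≡.trans (·ₛ-⊛ r G F j a b c d) (·ₛ-cong r (*-comm G F) j a b c d))

  ·ₛ-assoc : ∀ r s F → r ·ₛ (s ·ₛ F) ≈ₛ (r * s) ·ₛ F
  ·ₛ-assoc r s F j a b c d = ≡.sym (ℚₚ.*-assoc r s _)

  ·ₛ-⊛-·ₛ : ∀ r s F G → (r ·ₛ F) ⊛ (s ·ₛ G) ≈ₛ (r * s) ·ₛ (F ⊛ G)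
  ·ₛ-⊛-·ₛ r s F G j a b c d =
    ≡.trans (·ₛ-⊛ r F (s ·ₛ G) j a b c d) (≡.trans (·ₛ-cong r (⊛-·ₛ s F G) j a b c d) (·ₛ-assoc r s (F ⊛ G) j a b c d))

  Σ-coeff : ∀ n (F : ℕ → Series) j a b c d → Σ n F j a b c d ≡ Σ≤ n (λ i → F i j a b c d)
  Σ-coeff zero    F j a b c d = ≡.refl
  Σ-coeff (suc n) F j a b c d = ≡.cong (ℚ._+ F (suc n) j a b c d) (Σ-coeff n F j a b c d)

  Σ-·ₛ : ∀ n (r : ℕ → ℚ) F → Σ n (λ i → r i ·ₛ F) ≈ₛ Σ≤ n r ·ₛ F
  Σ-·ₛ n r F j a b c d = ≡.trans (Σ-coeff n (λ i → r i ·ₛ F) j a b c d) (Σ≤-*ʳ n (F j a b c d) r)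

  ·ₛ-Σ : ∀ n r (F : ℕ → Series) → r ·ₛ Σ n F ≈ₛ Σ n (λ i → r ·ₛ F i)
  ·ₛ-Σ n r F j a b c d =
    ≡.trans (≡.cong (r *_) (Σ-coeff n F j a b c d))
            (≡.trans (≡.sym (Σ≤-*ˡ n r _)) (≡.sym (Σ-coeff n _ j a b c d)))

module Order where

  open import Data.Rational as ℚ using (ℚ; 0ℚ; _*_)
  import Data.Rational.Properties as ℚₚ
  open SeriesRing using (Σ≤-cong; commutativeRing)
  open RationalSums
  open Scalars
  open FiniteSum commutativeRing using (Σ; Σ-*ˡ; Σ-*ʳ)

  degree : ℕ → ℕ → ℕ → ℕ → ℕ → ℕ
  degree j a b c d = j ℕ.+ a ℕ.+ b ℕ.+ c ℕ.+ d

  -- Ord≥ p F says F ∈ 𝔪ᵖ, where 𝔪 = (q, X₁, X₂, Y₁, Y₂).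
  Ord≥ : ℕ → Series → Set
  Ord≥ p F = ∀ j a b c d → degree j a b c d < p → F j a b c d ≡ 0ℚ

  Ord≥1 : ∀ F → F 0 0 0 0 0 ≡ 0ℚ → Ord≥ 1 F
  Ord≥1 F F₀≡0 zero    zero    zero    zero    zero    _          = F₀≡0
  Ord≥1 F F₀≡0 (suc j) a       b       c       d       (s≤s ())
  Ord≥1 F F₀≡0 zero    (suc a) b       c       d       (s≤s ())
  Ord≥1 F F₀≡0 zero    zero    (suc b) c       d       (s≤s ())
  Ord≥1 F F₀≡0 zero    zero    zero    (suc c) d       (s≤s ())
  Ord≥1 F F₀≡0 zero    zero    zero    zero    (suc d) (s≤s ())

  Ord≥-mono : ∀ {p q} F → q ≤ p → Ord≥ p F → Ord≥ q F
  Ord≥-mono F q≤p F∈𝔪ᵖ j a b c d deg<q = F∈𝔪ᵖ j a b c d (ℕₚ.<-≤-trans deg<q q≤p)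

  Ord≥-⊕ : ∀ {p} F G → Ord≥ p F → Ord≥ p G → Ord≥ p (F ⊕ G)
  Ord≥-⊕ F G F∈𝔪ᵖ G∈𝔪ᵖ j a b c d deg<p = ≡.cong₂ ℚ._+_ (F∈𝔪ᵖ j a b c d deg<p) (G∈𝔪ᵖ j a b c d deg<p)

  Ord≥-⊝ : ∀ {p} F → Ord≥ p F → Ord≥ p (⊝ F)
  Ord≥-⊝ F F∈𝔪ᵖ j a b c d deg<p = ≡.cong ℚ.-_ (F∈𝔪ᵖ j a b c d deg<p)

  Ord≥-·ₛ : ∀ {p} r F → Ord≥ p F → Ord≥ p (r ·ₛ F)
  Ord≥-·ₛ r F F∈𝔪ᵖ j a b c d deg<p = ≡.trans (≡.cong (r *_) (F∈𝔪ᵖ j a b c d deg<p)) (ℚₚ.*-zeroʳ r)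

  degree-split : ∀ {j a b c d j₁ a₁ b₁ c₁ d₁} → j₁ ≤ j → a₁ ≤ a → b₁ ≤ b → c₁ ≤ c → d₁ ≤ d →
    degree j₁ a₁ b₁ c₁ d₁ ℕ.+ degree (j ∸ j₁) (a ∸ a₁) (b ∸ b₁) (c ∸ c₁) (d ∸ d₁) ≡ degree j a b c d
  degree-split {j} {a} {b} {c} {d} {j₁} {a₁} {b₁} {c₁} {d₁} j₁≤j a₁≤a b₁≤b c₁≤c d₁≤d =
    ≡.trans (regroup j₁ a₁ b₁ c₁ d₁ (j ∸ j₁) (a ∸ a₁) (b ∸ b₁) (c ∸ c₁) (d ∸ d₁))
      (≡.cong₂ ℕ._+_ (≡.cong₂ ℕ._+_ (≡.cong₂ ℕ._+_ (≡.cong₂ ℕ._+_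
        (ℕₚ.m+[n∸m]≡n j₁≤j) (ℕₚ.m+[n∸m]≡n a₁≤a)) (ℕₚ.m+[n∸m]≡n b₁≤b)) (ℕₚ.m+[n∸m]≡n c₁≤c)) (ℕₚ.m+[n∸m]≡n d₁≤d))
    where
    open import Data.Nat.Tactic.RingSolver using (solve-∀)
    regroup : ∀ j₁ a₁ b₁ c₁ d₁ j₂ a₂ b₂ c₂ d₂ →
      (j₁ ℕ.+ a₁ ℕ.+ b₁ ℕ.+ c₁ ℕ.+ d₁) ℕ.+ (j₂ ℕ.+ a₂ ℕ.+ b₂ ℕ.+ c₂ ℕ.+ d₂) ≡
      (j₁ ℕ.+ j₂) ℕ.+ (a₁ ℕ.+ a₂) ℕ.+ (b₁ ℕ.+ b₂) ℕ.+ (c₁ ℕ.+ c₂) ℕ.+ (d₁ ℕ.+ d₂)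
    regroup = solve-∀

  Ord≥-⊛ : ∀ {p r} F G → Ord≥ p F → Ord≥ r G → Ord≥ (p ℕ.+ r) (F ⊛ G)
  Ord≥-⊛ {p} {r} F G F∈𝔪ᵖ G∈𝔪ʳ j a b c d deg<p+r =
    Σ≤-zero j λ _ j₁≤j → Σ≤-zero a λ _ a₁≤a → Σ≤-zero b λ _ b₁≤b → Σ≤-zero c λ _ c₁≤c → Σ≤-zero d λ _ d₁≤d →
      term (degree-split j₁≤j a₁≤a b₁≤b c₁≤c d₁≤d)
    where
    term : ∀ {j₁ a₁ b₁ c₁ d₁} →
      degree j₁ a₁ b₁ c₁ d₁ ℕ.+ degree (j ∸ j₁) (a ∸ a₁) (b ∸ b₁) (c ∸ c₁) (d ∸ d₁) ≡ degree j a b c d →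
      F j₁ a₁ b₁ c₁ d₁ * G (j ∸ j₁) (a ∸ a₁) (b ∸ b₁) (c ∸ c₁) (d ∸ d₁) ≡ 0ℚ
    term {j₁} {a₁} {b₁} {c₁} {d₁} split with degree j₁ a₁ b₁ c₁ d₁ ℕ.<? p
    ... | yes deg₁<p = ≡.trans (≡.cong (_* G (j ∸ j₁) (a ∸ a₁) (b ∸ b₁) (c ∸ c₁) (d ∸ d₁)) (F∈𝔪ᵖ j₁ a₁ b₁ c₁ d₁ deg₁<p))
                               (ℚₚ.*-zeroˡ (G (j ∸ j₁) (a ∸ a₁) (b ∸ b₁) (c ∸ c₁) (d ∸ d₁)))
    ... | no  deg₁≮p = ≡.trans (≡.cong (F j₁ a₁ b₁ c₁ d₁ *_) (G∈𝔪ʳ (j ∸ j₁) (a ∸ a₁) (b ∸ b₁) (c ∸ c₁) (d ∸ d₁) deg₂<r))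
                               (ℚₚ.*-zeroʳ (F j₁ a₁ b₁ c₁ d₁))
      where
      deg₂<r = ℕₚ.+-cancelˡ-< p _ _ (ℕₚ.≤-<-trans (ℕₚ.+-monoˡ-≤ _ (ℕₚ.≮⇒≥ deg₁≮p))
                                                  (≡.subst (_< p ℕ.+ r) (≡.sym split) deg<p+r))

  Ord≥-^ : ∀ F → Ord≥ 1 F → ∀ n → Ord≥ n (F ^ₛ n)
  Ord≥-^ F F∈𝔪 zero    j a b c d ()
  Ord≥-^ F F∈𝔪 (suc n) = Ord≥-⊛ F (F ^ₛ n) F∈𝔪 (Ord≥-^ F F∈𝔪 n)

  -- Meant for families with φ n ∈ 𝔪ⁿ: a coefficient of total degree N then only receives the terms n ≤ N.
  Σ∞ : (ℕ → Series) → Series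
  Σ∞ φ j a b c d = Σ≤ (degree j a b c d) (λ n → φ n j a b c d)

  Σ∞-cong : ∀ {φ ψ} → (∀ n → φ n ≈ₛ ψ n) → Σ∞ φ ≈ₛ Σ∞ ψ
  Σ∞-cong φ≈ψ j a b c d = Σ≤-cong (degree j a b c d) (λ n → φ≈ψ n j a b c d)

  Σ∞-truncate : ∀ φ → (∀ n → Ord≥ n (φ n)) → ∀ M j a b c d → degree j a b c d ≤ M →
                Σ∞ φ j a b c d ≡ Σ M φ j a b c d
  Σ∞-truncate φ φ∈𝔪ⁿ M j a b c d deg≤M =
    ≡.trans (≡.sym (Σ≤-extend M deg≤M (λ n deg<n _ → φ∈𝔪ⁿ n j a b c d deg<n))) (≡.sym (Σ-coeff M φ j a b c d))

  ⊛-cong-≤degree : ∀ D {F F′ G G′} →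
    (∀ j a b c d → degree j a b c d ≤ D → F j a b c d ≡ F′ j a b c d) →
    (∀ j a b c d → degree j a b c d ≤ D → G j a b c d ≡ G′ j a b c d) →
    ∀ j a b c d → degree j a b c d ≤ D → (F ⊛ G) j a b c d ≡ (F′ ⊛ G′) j a b c d
  ⊛-cong-≤degree D F≈F′ G≈G′ j a b c d deg≤D =
    Σ≤-cong-≤ j λ j₁ j₁≤j → Σ≤-cong-≤ a λ a₁ a₁≤a → Σ≤-cong-≤ b λ b₁ b₁≤b → Σ≤-cong-≤ c λ c₁ c₁≤c → Σ≤-cong-≤ d λ d₁ d₁≤d →
      let split = ℕₚ.≤-reflexive (degree-split j₁≤j a₁≤a b₁≤b c₁≤c d₁≤d) in
      ≡.cong₂ _*_ (F≈F′ _ _ _ _ _ (ℕₚ.≤-trans (ℕₚ.≤-trans (ℕₚ.m≤m+n _ _) split) deg≤D))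
                  (G≈G′ _ _ _ _ _ (ℕₚ.≤-trans (ℕₚ.≤-trans (ℕₚ.m≤n+m _ (degree j₁ a₁ b₁ c₁ d₁)) split) deg≤D))

  Σ∞-⊛ : ∀ φ ψ → (∀ n → Ord≥ n (φ n)) → (∀ n → Ord≥ n (ψ n)) →
         Σ∞ φ ⊛ Σ∞ ψ ≈ₛ Σ∞ (λ n → Σ n (λ i → φ i ⊛ ψ (n ∸ i)))
  Σ∞-⊛ φ ψ φ∈𝔪ⁿ ψ∈𝔪ⁿ j a b c d = begin
    (Σ∞ φ ⊛ Σ∞ ψ) j a b c d
      ≡⟨ ⊛-cong-≤degree D (Σ∞-truncate φ φ∈𝔪ⁿ D) (Σ∞-truncate ψ ψ∈𝔪ⁿ D) j a b c d ℕₚ.≤-refl ⟩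
    (Σ D φ ⊛ Σ D ψ) j a b c d
      ≡⟨ distribute j a b c d ⟩
    Σ D (λ n → Σ D (λ n′ → φ n ⊛ ψ n′)) j a b c d
      ≡⟨ ≡.trans (Σ-coeff D _ j a b c d) (Σ≤-cong D (λ n → Σ-coeff D _ j a b c d)) ⟩
    Σ≤ D (λ n → Σ≤ D (λ n′ → (φ n ⊛ ψ n′) j a b c d))
      ≡⟨ Σ≤-cong-≤ D (λ n n≤D → Σ≤-extend D (ℕₚ.m∸n≤m D n) (λ n′ D∸n<n′ _ →
           Ord≥-⊛ (φ n) (ψ n′) (φ∈𝔪ⁿ n) (ψ∈𝔪ⁿ n′) j a b c d
                  (≡.subst (_< n ℕ.+ n′) (ℕₚ.m+[n∸m]≡n n≤D) (ℕₚ.+-monoʳ-< n D∸n<n′)))) ⟩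
    Σ≤ D (λ n → Σ≤ (D ∸ n) (λ n′ → (φ n ⊛ ψ n′) j a b c d))
      ≡⟨ Σ≤-triangle D (λ n n′ → (φ n ⊛ ψ n′) j a b c d) ⟨
    Σ≤ D (λ N → Σ≤ N (λ i → (φ i ⊛ ψ (N ∸ i)) j a b c d))
      ≡⟨ Σ≤-cong D (λ N → Σ-coeff N (λ i → φ i ⊛ ψ (N ∸ i)) j a b c d) ⟨
    Σ∞ (λ n → Σ n (λ i → φ i ⊛ ψ (n ∸ i))) j a b c d
      ∎
    where
    open ≡.≡-Reasoning
    D = degree j a b c d
    open CommutativeRing commutativeRing using (trans; sym)
    open FiniteSum commutativeRing using (Σ-cong)
    distribute : Σ D φ ⊛ Σ D ψ ≈ₛ Σ D (λ n → Σ D (λ n′ → φ n ⊛ ψ n′))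
    distribute = sym (trans (Σ-cong D (λ n → Σ-*ˡ D (φ n) ψ)) (Σ-*ʳ D (Σ D ψ) φ))

module Substitution where

  open import Data.Rational using (ℚ; 0ℚ; 1ℚ; _+_; _*_; -_)
  import Data.Rational.Properties as ℚₚ
  open SeriesRing using (Σ≤-cong; commutativeRing)
  open RationalSums
  open Scalars
  open Order
  open CommutativeRing commutativeRing
    using (setoid; refl; sym; trans; reflexive; *-cong; *-congˡ; *-congʳ; *-assoc; *-identityˡ; *-identityʳ)
  open FiniteSum commutativeRing using (Σ; Σ-cong-≤)
  open import Relation.Binary.Reasoning.Setoid setoid

  infixl 7 _∗_

  _∗_ : (ℕ → ℚ) → (ℕ → ℚ) → ℕ → ℚ
  (c ∗ c′) n = Σ≤ n (λ i → c i * c′ (n ∸ i))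

  δ₀ δ₁ : ℕ → ℚ
  δ₀ zero    = 1ℚ
  δ₀ (suc _) = 0ℚ
  δ₁ 1 = 1ℚ
  δ₁ _ = 0ℚ

  shift : (ℕ → ℚ) → ℕ → ℚ
  shift c zero    = 0ℚ
  shift c (suc n) = c n

  ^ₛ-cong : ∀ {F G} n → F ≈ₛ G → F ^ₛ n ≈ₛ G ^ₛ n
  ^ₛ-cong zero    F≈G = refl
  ^ₛ-cong (suc n) F≈G = *-cong F≈G (^ₛ-cong n F≈G)

  ^ₛ-+ : ∀ F i k → F ^ₛ i ⊛ F ^ₛ k ≈ₛ F ^ₛ (i ℕ.+ k)
  ^ₛ-+ F zero    k = *-identityˡ (F ^ₛ k)
  ^ₛ-+ F (suc i) k = trans (*-assoc F (F ^ₛ i) (F ^ₛ k)) (*-congˡ {F} (^ₛ-+ F i k))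

  ^ₛ-split : ∀ F {n i} → i ≤ n → F ^ₛ i ⊛ F ^ₛ (n ∸ i) ≈ₛ F ^ₛ n
  ^ₛ-split F {n} {i} i≤n = trans (^ₛ-+ F i (n ∸ i)) (reflexive (≡.cong (F ^ₛ_) (ℕₚ.m+[n∸m]≡n i≤n)))

  subst₁-summable : ∀ (c : ℕ → ℚ) F → Ord≥ 1 F → ∀ n → Ord≥ n (c n ·ₛ (F ^ₛ n))
  subst₁-summable c F F∈𝔪 n = Ord≥-·ₛ (c n) (F ^ₛ n) (Ord≥-^ F F∈𝔪 n)

  subst₁-cong : ∀ {c c′} F → (∀ n → c n ≡ c′ n) → subst₁ c F ≈ₛ subst₁ c′ F
  subst₁-cong F c≡c′ j a b c d = Σ≤-cong (degree j a b c d) (λ n → ≡.cong (_* (F ^ₛ n) j a b c d) (c≡c′ n))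

  subst₁-congʳ : ∀ c {F G} → F ≈ₛ G → subst₁ c F ≈ₛ subst₁ c G
  subst₁-congʳ c F≈G j a b c′ d = Σ≤-cong (degree j a b c′ d) (λ n → ≡.cong (c n *_) (^ₛ-cong n F≈G j a b c′ d))

  subst₁-+ : ∀ (c c′ : ℕ → ℚ) F → subst₁ (λ n → c n + c′ n) F ≈ₛ subst₁ c F ⊕ subst₁ c′ F
  subst₁-+ c c′ F j a b c₁ d =
    ≡.trans (Σ≤-cong (degree j a b c₁ d) (λ n → ℚₚ.*-distribʳ-+ ((F ^ₛ n) j a b c₁ d) (c n) (c′ n)))
            (Σ≤-distrib-+ (degree j a b c₁ d) _ _)

  subst₁-·ₛ : ∀ r (c : ℕ → ℚ) F → subst₁ (λ n → r * c n) F ≈ₛ r ·ₛ subst₁ c F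
  subst₁-·ₛ r c F j a b c₁ d =
    ≡.trans (Σ≤-cong (degree j a b c₁ d) (λ n → ℚₚ.*-assoc r (c n) ((F ^ₛ n) j a b c₁ d)))
            (Σ≤-*ˡ (degree j a b c₁ d) r _)

  subst₁-neg : ∀ (c : ℕ → ℚ) F → subst₁ (λ n → - c n) F ≈ₛ ⊝ subst₁ c F
  subst₁-neg c F j a b c₁ d =
    ≡.trans (Σ≤-cong (degree j a b c₁ d) (λ n → ≡.sym (ℚₚ.neg-distribˡ-* (c n) ((F ^ₛ n) j a b c₁ d))))
            (Σ≤-neg (degree j a b c₁ d) _)

  subst₁-δ₀ : ∀ F → subst₁ δ₀ F ≈ₛ oneₛ
  subst₁-δ₀ F j a b c d = ≡.trans (Σ≤-single _ 0 z≤n vanish) (ℚₚ.*-identityˡ _)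
    where
    vanish : ∀ i → i ≤ degree j a b c d → i ≢ 0 → δ₀ i * (F ^ₛ i) j a b c d ≡ 0ℚ
    vanish zero    _ 0≢0 = ⊥-elim (0≢0 ≡.refl)
    vanish (suc i) _ _   = ℚₚ.*-zeroˡ ((F ^ₛ suc i) j a b c d)

  subst₁-δ₁ : ∀ F → Ord≥ 1 F → subst₁ δ₁ F ≈ₛ F
  subst₁-δ₁ F F∈𝔪 j a b c d with degree j a b c d in deg≡
  ... | zero  = ≡.trans (ℚₚ.*-zeroˡ ((F ^ₛ 0) j a b c d)) (≡.sym (F∈𝔪 j a b c d (≡.subst (_< 1) (≡.sym deg≡) (s≤s z≤n))))
  ... | suc N = ≡.trans (Σ≤-single (suc N) 1 (s≤s z≤n) vanish)
                        (≡.trans (ℚₚ.*-identityˡ _) (*-identityʳ F j a b c d))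
    where
    vanish : ∀ i → i ≤ suc N → i ≢ 1 → δ₁ i * (F ^ₛ i) j a b c d ≡ 0ℚ
    vanish zero          _ _   = ℚₚ.*-zeroˡ ((F ^ₛ 0) j a b c d)
    vanish (suc zero)    _ 1≢1 = ⊥-elim (1≢1 ≡.refl)
    vanish (suc (suc i)) _ _   = ℚₚ.*-zeroˡ ((F ^ₛ suc (suc i)) j a b c d)

  δ₁-∗ : ∀ (c : ℕ → ℚ) n → (δ₁ ∗ c) n ≡ shift c n
  δ₁-∗ c zero    = ℚₚ.*-zeroˡ (c 0)
  δ₁-∗ c (suc n) = ≡.trans (Σ≤-single (suc n) 1 (s≤s z≤n) vanish) (ℚₚ.*-identityˡ (c n))
    where
    vanish : ∀ i → i ≤ suc n → i ≢ 1 → δ₁ i * c (suc n ∸ i) ≡ 0ℚ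
    vanish zero          _ _   = ℚₚ.*-zeroˡ (c (suc n))
    vanish (suc zero)    _ 1≢1 = ⊥-elim (1≢1 ≡.refl)
    vanish (suc (suc i)) _ _   = ℚₚ.*-zeroˡ (c (n ∸ suc i))

  subst₁-⊛ : ∀ (c c′ : ℕ → ℚ) F → Ord≥ 1 F → subst₁ c F ⊛ subst₁ c′ F ≈ₛ subst₁ (c ∗ c′) F
  subst₁-⊛ c c′ F F∈𝔪 = begin
    Σ∞ (λ n → c n ·ₛ (F ^ₛ n)) ⊛ Σ∞ (λ n → c′ n ·ₛ (F ^ₛ n))
      ≈⟨ Σ∞-⊛ (λ n → c n ·ₛ (F ^ₛ n)) (λ n → c′ n ·ₛ (F ^ₛ n))
              (subst₁-summable c F F∈𝔪) (subst₁-summable c′ F F∈𝔪) ⟩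
    Σ∞ (λ n → Σ n (λ i → (c i ·ₛ (F ^ₛ i)) ⊛ (c′ (n ∸ i) ·ₛ (F ^ₛ (n ∸ i)))))
      ≈⟨ Σ∞-cong (λ n → trans (Σ-cong-≤ n (term n)) (Σ-·ₛ n (λ i → c i * c′ (n ∸ i)) (F ^ₛ n))) ⟩
    Σ∞ (λ n → (c ∗ c′) n ·ₛ (F ^ₛ n))
      ∎
    where
    term : ∀ n i → i ≤ n → (c i ·ₛ (F ^ₛ i)) ⊛ (c′ (n ∸ i) ·ₛ (F ^ₛ (n ∸ i))) ≈ₛ (c i * c′ (n ∸ i)) ·ₛ (F ^ₛ n)
    term n i i≤n = trans (·ₛ-⊛-·ₛ (c i) (c′ (n ∸ i)) (F ^ₛ i) (F ^ₛ (n ∸ i))) (·ₛ-cong (c i * c′ (n ∸ i)) (^ₛ-split F i≤n))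

  ⊛-subst₁ : ∀ (c : ℕ → ℚ) F → Ord≥ 1 F → F ⊛ subst₁ c F ≈ₛ subst₁ (shift c) F
  ⊛-subst₁ c F F∈𝔪 = begin
    F ⊛ subst₁ c F          ≈⟨ *-congʳ {subst₁ c F} (subst₁-δ₁ F F∈𝔪) ⟨
    subst₁ δ₁ F ⊛ subst₁ c F ≈⟨ subst₁-⊛ δ₁ c F F∈𝔪 ⟩
    subst₁ (δ₁ ∗ c) F       ≈⟨ subst₁-cong F (δ₁-∗ c) ⟩
    subst₁ (shift c) F      ∎

module Factorials where

  open import Data.Nat using (NonZero; _!)
  open import Data.Nat.Properties using (_!≢0; _!*_!≢0; m*n≢0)
  open import Data.Nat.Combinatorics using (_C_; k![n∸k]!∣n!)
  open import Data.Nat.Combinatorics.Specification using (nCk≡n!/k![n-k]!)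
  open import Data.Nat.DivMod using (m/n*n≡m)
  open import Data.Integer as ℤ using (+_)
  import Data.Integer.Properties as ℤₚ
  open import Data.Rational using (ℚ; 1ℚ; _/_; _+_; _*_)
  import Data.Rational.Properties as ℚₚ
  open import Data.Rational.Unnormalised using (mkℚᵘ; *≡*)
  import Data.Rational.Unnormalised.Properties as ℚᵘₚ

  /-* : ∀ i j m n .{{_ : NonZero m}} .{{_ : NonZero n}} →
        (i / m) * (j / n) ≡ ((i ℤ.* j) / (m ℕ.* n)) {{m*n≢0 m n}}
  /-* i j (suc m) (suc n) = ≡.trans (≡.sym (ℚₚ.fromℚᵘ-toℚᵘ _)) (ℚₚ.fromℚᵘ-cong
    (ℚᵘₚ.≃-trans (ℚₚ.toℚᵘ-homo-* (i / suc m) (j / suc n))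
                 (ℚᵘₚ.*-cong (ℚₚ.toℚᵘ-fromℚᵘ (mkℚᵘ i m)) (ℚₚ.toℚᵘ-fromℚᵘ (mkℚᵘ j n)))))

  /-+ : ∀ i j m n .{{_ : NonZero m}} .{{_ : NonZero n}} →
        (i / m) + (j / n) ≡ ((i ℤ.* + n ℤ.+ j ℤ.* + m) / (m ℕ.* n)) {{m*n≢0 m n}}
  /-+ i j (suc m) (suc n) = ≡.trans (≡.sym (ℚₚ.fromℚᵘ-toℚᵘ _)) (ℚₚ.fromℚᵘ-cong
    (ℚᵘₚ.≃-trans (ℚₚ.toℚᵘ-homo-+ (i / suc m) (j / suc n))
                 (ℚᵘₚ.+-cong (ℚₚ.toℚᵘ-fromℚᵘ (mkℚᵘ i m)) (ℚₚ.toℚᵘ-fromℚᵘ (mkℚᵘ j n)))))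

  /-≡ : ∀ i j m n .{{_ : NonZero m}} .{{_ : NonZero n}} → i ℤ.* + n ≡ j ℤ.* + m → i / m ≡ j / n
  /-≡ i j (suc m) (suc n) eq = ℚₚ.fromℚᵘ-cong {mkℚᵘ i m} {mkℚᵘ j n} (*≡* eq)

  !*inv! : ∀ n → ℕ→ℚ (n !) * inv! n ≡ 1ℚ
  !*inv! n = ≡.trans (/-* (+ (n !)) (+ 1) 1 (n !) {{_}} {{n !≢0}})
                     (/-≡ (+ (n !) ℤ.* + 1) (+ 1) (1 ℕ.* n !) 1 {{m*n≢0 1 (n !) {{_}} {{n !≢0}}}} cross)
    where
    cross : (+ (n !) ℤ.* + 1) ℤ.* + 1 ≡ + 1 ℤ.* + (1 ℕ.* n !)
    cross = ≡.trans (ℤₚ.*-identityʳ _) (≡.trans (ℤₚ.*-identityʳ _)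
              (≡.sym (≡.trans (ℤₚ.*-identityˡ _) (≡.cong +_ (ℕₚ.*-identityˡ (n !))))))

  ℕ→ℚ-suc : ∀ n → ℕ→ℚ (suc n) ≡ 1ℚ + ℕ→ℚ n
  ℕ→ℚ-suc n = ≡.sym (≡.trans (/-+ (+ 1) (+ n) 1 1)
    (≡.cong (_/ 1) (≡.trans (≡.cong₂ ℤ._+_ (ℤₚ.*-identityʳ (+ 1)) (ℤₚ.*-identityʳ (+ n))) (≡.sym (ℤₚ.pos-+ 1 n)))))

  C*!*!≡! : ∀ {n i} → i ≤ n → (n C i) ℕ.* (i ! ℕ.* (n ∸ i) !) ≡ n !
  C*!*!≡! {n} {i} i≤n = ≡.trans (≡.cong (ℕ._* (i ! ℕ.* (n ∸ i) !)) (nCk≡n!/k![n-k]! i≤n))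
                                (m/n*n≡m {{i !* (n ∸ i) !≢0}} (k![n∸k]!∣n! i≤n))

  inv!-C : ∀ {n i} → i ≤ n → inv! n * ℕ→ℚ (n C i) ≡ inv! i * inv! (n ∸ i)
  inv!-C {n} {i} i≤n = begin
    inv! n * ℕ→ℚ (n C i)
      ≡⟨ /-* (+ 1) (+ (n C i)) (n !) 1 {{n !≢0}} ⟩
    ((+ 1 ℤ.* + (n C i)) / (n ! ℕ.* 1)) {{n!*1≢0}}
      ≡⟨ /-≡ (+ 1 ℤ.* + (n C i)) (+ 1 ℤ.* + 1) (n ! ℕ.* 1) (i ! ℕ.* (n ∸ i) !) {{n!*1≢0}} {{i !* (n ∸ i) !≢0}} cross ⟩
    ((+ 1 ℤ.* + 1) / (i ! ℕ.* (n ∸ i) !)) {{i !* (n ∸ i) !≢0}}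
      ≡⟨ /-* (+ 1) (+ 1) (i !) ((n ∸ i) !) {{i !≢0}} {{(n ∸ i) !≢0}} ⟨
    inv! i * inv! (n ∸ i)
      ∎
    where
    open ≡.≡-Reasoning
    n!*1≢0 : NonZero (n ! ℕ.* 1)
    n!*1≢0 = m*n≢0 (n !) 1 {{n !≢0}}
    cross : (+ 1 ℤ.* + (n C i)) ℤ.* + (i ! ℕ.* (n ∸ i) !) ≡ (+ 1 ℤ.* + 1) ℤ.* + (n ! ℕ.* 1)
    cross = begin
      (+ 1 ℤ.* + (n C i)) ℤ.* + (i ! ℕ.* (n ∸ i) !) ≡⟨ ≡.cong (ℤ._* + (i ! ℕ.* (n ∸ i) !)) (ℤₚ.*-identityˡ (+ (n C i))) ⟩
      + (n C i) ℤ.* + (i ! ℕ.* (n ∸ i) !)             ≡⟨ ℤₚ.pos-* (n C i) _ ⟨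
      + ((n C i) ℕ.* (i ! ℕ.* (n ∸ i) !))              ≡⟨ ≡.cong +_ (≡.trans (C*!*!≡! i≤n) (≡.sym (ℕₚ.*-identityʳ (n !)))) ⟩
      + (n ! ℕ.* 1)                                  ≡⟨ ℤₚ.*-identityˡ (+ (n ! ℕ.* 1)) ⟨
      (+ 1 ℤ.* + 1) ℤ.* + (n ! ℕ.* 1)                ∎

module Exponential where

  open import Data.Fin using (toℕ)
  open import Data.Nat.Combinatorics using (_C_)
  open import Data.Rational using (ℚ; 0ℚ; 1ℚ; _+_; _*_)
  import Data.Rational.Properties as ℚₚ
  open SeriesRing using (commutativeRing)
  open RationalSums
  open Scalars
  open Order
  open Substitution using (subst₁-summable)
  open Factorials using (ℕ→ℚ-suc; inv!-C)
  open CommutativeRing commutativeRing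
    using (0#; setoid; refl; sym; trans; +-congˡ; +-identityʳ; *-cong; *-congˡ; commutativeSemiring; semiring; +-rawMonoid)
  open FiniteSum commutativeRing using (Σ; Σ-cong; Σ-cong-≤; Σ-unfoldˡ)
  import Algebra.Properties.CommutativeSemiring.Binomial commutativeSemiring as Binomial
  open import Algebra.Definitions.RawMonoid +-rawMonoid using (sum; _×_)
  open import Algebra.Properties.Semiring.Exp semiring using (_^_)

  ^≈^ₛ : ∀ n F → F ^ n ≈ₛ F ^ₛ n
  ^≈^ₛ zero    F = refl
  ^≈^ₛ (suc n) F = *-congˡ {F} (^≈^ₛ n F)

  sum≈Σ : ∀ n (f : ℕ → Series) → sum {suc n} (λ k → f (toℕ k)) ≈ₛ Σ n f
  sum≈Σ zero    f = +-identityʳ (f 0)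
  sum≈Σ (suc n) f = trans (+-congˡ {f 0} (sum≈Σ n (λ i → f (suc i)))) (sym (Σ-unfoldˡ n f))

  ×≈·ₛ : ∀ k F → k × F ≈ₛ ℕ→ℚ k ·ₛ F
  ×≈·ₛ zero    F j a b c d = ≡.sym (ℚₚ.*-zeroˡ (F j a b c d))
  ×≈·ₛ (suc k) F j a b c d = begin
    F j a b c d + (k × F) j a b c d         ≡⟨ ≡.cong (F j a b c d +_) (×≈·ₛ k F j a b c d) ⟩
    F j a b c d + ℕ→ℚ k * F j a b c d       ≡⟨ ≡.cong (_+ ℕ→ℚ k * F j a b c d) (ℚₚ.*-identityˡ (F j a b c d)) ⟨
    1ℚ * F j a b c d + ℕ→ℚ k * F j a b c d  ≡⟨ ℚₚ.*-distribʳ-+ (F j a b c d) 1ℚ (ℕ→ℚ k) ⟨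
    (1ℚ + ℕ→ℚ k) * F j a b c d              ≡⟨ ≡.cong (_* F j a b c d) (ℕ→ℚ-suc k) ⟨
    ℕ→ℚ (suc k) * F j a b c d               ∎
    where open ≡.≡-Reasoning

  binomial : ∀ n F G → (F ⊕ G) ^ₛ n ≈ₛ Σ n (λ i → ℕ→ℚ (n C i) ·ₛ (F ^ₛ i ⊛ G ^ₛ (n ∸ i)))
  binomial n F G = begin
    (F ⊕ G) ^ₛ n
      ≈⟨ ^≈^ₛ n (F ⊕ G) ⟨
    (F ⊕ G) ^ n
      ≈⟨ Binomial.theorem n F G ⟩
    Binomial.binomialExpansion F G n
      ≈⟨ sum≈Σ n (λ i → (n C i) × (F ^ i ⊛ G ^ (n ∸ i))) ⟩
    Σ n (λ i → (n C i) × (F ^ i ⊛ G ^ (n ∸ i)))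
      ≈⟨ Σ-cong n (λ i → trans (×≈·ₛ (n C i) _) (·ₛ-cong (ℕ→ℚ (n C i)) (*-cong (^≈^ₛ i F) (^≈^ₛ (n ∸ i) G)))) ⟩
    Σ n (λ i → ℕ→ℚ (n C i) ·ₛ (F ^ₛ i ⊛ G ^ₛ (n ∸ i)))
      ∎
    where open import Relation.Binary.Reasoning.Setoid setoid

  expₛ-⊕ : ∀ F G → Ord≥ 1 F → Ord≥ 1 G → expₛ (F ⊕ G) ≈ₛ expₛ F ⊛ expₛ G
  expₛ-⊕ F G F∈𝔪 G∈𝔪 = sym (begin
    Σ∞ (λ n → inv! n ·ₛ (F ^ₛ n)) ⊛ Σ∞ (λ n → inv! n ·ₛ (G ^ₛ n))
      ≈⟨ Σ∞-⊛ (λ n → inv! n ·ₛ (F ^ₛ n)) (λ n → inv! n ·ₛ (G ^ₛ n))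
              (subst₁-summable inv! F F∈𝔪) (subst₁-summable inv! G G∈𝔪) ⟩
    Σ∞ (λ n → Σ n (λ i → (inv! i ·ₛ (F ^ₛ i)) ⊛ (inv! (n ∸ i) ·ₛ (G ^ₛ (n ∸ i)))))
      ≈⟨ Σ∞-cong (λ n → trans (Σ-cong-≤ n (term n)) (sym (trans (·ₛ-cong (inv! n) (binomial n F G)) (·ₛ-Σ n (inv! n) _)))) ⟩
    Σ∞ (λ n → inv! n ·ₛ ((F ⊕ G) ^ₛ n))
      ∎)
    where
    open import Relation.Binary.Reasoning.Setoid setoid
    term : ∀ n i → i ≤ n → (inv! i ·ₛ (F ^ₛ i)) ⊛ (inv! (n ∸ i) ·ₛ (G ^ₛ (n ∸ i)))
                         ≈ₛ inv! n ·ₛ (ℕ→ℚ (n C i) ·ₛ (F ^ₛ i ⊛ G ^ₛ (n ∸ i)))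
    term n i i≤n = begin
      (inv! i ·ₛ (F ^ₛ i)) ⊛ (inv! (n ∸ i) ·ₛ (G ^ₛ (n ∸ i)))
        ≈⟨ ·ₛ-⊛-·ₛ (inv! i) (inv! (n ∸ i)) (F ^ₛ i) (G ^ₛ (n ∸ i)) ⟩
      (inv! i * inv! (n ∸ i)) ·ₛ (F ^ₛ i ⊛ G ^ₛ (n ∸ i))
        ≈⟨ (λ j a b c d → ≡.cong (_* (F ^ₛ i ⊛ G ^ₛ (n ∸ i)) j a b c d) (inv!-C i≤n)) ⟨
      (inv! n * ℕ→ℚ (n C i)) ·ₛ (F ^ₛ i ⊛ G ^ₛ (n ∸ i))
        ≈⟨ ·ₛ-assoc (inv! n) (ℕ→ℚ (n C i)) (F ^ₛ i ⊛ G ^ₛ (n ∸ i)) ⟨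
      inv! n ·ₛ (ℕ→ℚ (n C i) ·ₛ (F ^ₛ i ⊛ G ^ₛ (n ∸ i)))
        ∎

  expₛ-0 : ∀ {F} → F ≈ₛ 0# → expₛ F ≈ₛ oneₛ
  expₛ-0 {F} F≈0 j a b c d = ≡.trans (Σ≤-single (degree j a b c d) 0 z≤n vanish) (ℚₚ.*-identityˡ (oneₛ j a b c d))
    where
    vanish : ∀ i → i ≤ degree j a b c d → i ≢ 0 → inv! i * (F ^ₛ i) j a b c d ≡ 0ℚ
    vanish zero    _ 0≢0 = ⊥-elim (0≢0 ≡.refl)
    vanish (suc i) _ _   = ≡.trans (≡.cong (inv! (suc i) *_) (Fⁱ⁺¹≈0 j a b c d)) (ℚₚ.*-zeroʳ (inv! (suc i)))
      where
      open CommutativeRing commutativeRing using (*-congʳ; zeroˡ)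
      Fⁱ⁺¹≈0 : F ^ₛ suc i ≈ₛ 0#
      Fⁱ⁺¹≈0 = trans (*-congʳ {F ^ₛ i} F≈0) (zeroˡ (F ^ₛ i))

module BernoulliCoefficients where

  open import Function using (_∘_)
  open import Data.List using (_∷_; zipWith; map; applyUpTo)
  open import Data.Rational using (ℚ; 0ℚ; 1ℚ; ½; _+_; _*_; -_)
  import Data.Rational.Properties as ℚₚ
  open import Data.Rational.Solver using (module +-*-Solver)
  open SeriesRing using (Σ≤-cong)
  open RationalSums
  open Substitution using (_∗_; δ₀; δ₁; shift)
  open Factorials using (!*inv!)
  open ≡.≡-Reasoning

  bCoef : ℕ → ℚ
  bCoef n = hd (bl n)

  private
    map-applyUpTo : ∀ (g : ℕ → ℚ) (f : ℕ → ℕ) n → map g (applyUpTo f n) ≡ applyUpTo (g ∘ f) n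
    map-applyUpTo g f zero    = ≡.refl
    map-applyUpTo g f (suc n) = ≡.cong (g (f 0) ∷_) (map-applyUpTo g (f ∘ suc) n)

    sum-bl : ∀ n (h : ℕ → ℚ) → sumℚ (zipWith _*_ (bl n) (applyUpTo h (suc n))) ≡ Σ≤ n (λ k → bCoef (n ∸ k) * h k)
    sum-bl zero    h = ℚₚ.+-identityʳ _
    sum-bl (suc n) h = ≡.trans (≡.cong (bCoef (suc n) * h 0 +_) (sum-bl n (h ∘ suc)))
                               (≡.sym (Σ≤-unfoldˡ n (λ k → bCoef (suc n ∸ k) * h k)))

  bCoef-suc : ∀ n → bCoef (suc n) ≡ - Σ≤ n (λ k → bCoef (n ∸ k) * aCoef (suc k))
  bCoef-suc n = ≡.cong -_ (≡.trans (≡.cong (λ l → sumℚ (zipWith _*_ (bl n) l)) (map-applyUpTo (λ i → aCoef (suc i)) (λ i → i) (suc n)))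
                               (sum-bl n (λ i → aCoef (suc i))))

  aCoef∗bCoef : ∀ n → (aCoef ∗ bCoef) n ≡ δ₀ n
  aCoef∗bCoef zero    = ≡.refl
  aCoef∗bCoef (suc n) = begin
    (aCoef ∗ bCoef) (suc n)       ≡⟨ Σ≤-unfoldˡ n (λ i → aCoef i * bCoef (suc n ∸ i)) ⟩
    aCoef 0 * bCoef (suc n) + S′  ≡⟨ ≡.cong (λ z → aCoef 0 * z + S′) (bCoef-suc n) ⟩
    1ℚ * (- S) + S′               ≡⟨ ≡.cong (_+ S′) (ℚₚ.*-identityˡ (- S)) ⟩
    - S + S′                      ≡⟨ ≡.cong (- S +_) (Σ≤-cong n (λ k → ℚₚ.*-comm (aCoef (suc k)) (bCoef (n ∸ k)))) ⟩
    - S + S                       ≡⟨ ℚₚ.+-inverseˡ S ⟩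
    0ℚ                            ∎
    where
    S  = Σ≤ n (λ k → bCoef (n ∸ k) * aCoef (suc k))
    S′ = Σ≤ n (λ i → aCoef (suc i) * bCoef (n ∸ i))

  2β-coeff : ∀ n → 2ℚ * shift βCoef n ≡ δ₀ n + - (½ * δ₁ n) + - bCoef n
  2β-coeff zero          = ≡.refl
  2β-coeff (suc zero)    = ≡.refl
  2β-coeff (suc (suc k)) = ≡.trans cancel (≡.sym (ℚₚ.+-identityˡ (- bCoef (suc (suc k)))))
    where
    open +-*-Solver
    N = ℕ→ℚ (suc (suc k) ℕ.!)
    I = inv! (suc (suc k))
    regroup : ∀ t h N y I → t * (h * (N * y) * I) ≡ y * ((t * h) * (N * I))
    regroup = solve 5 (λ t h N y I → t :* (h :* (N :* y) :* I) := y :* ((t :* h) :* (N :* I))) ≡.refl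
    cancel : 2ℚ * - (½ * (N * bCoef (suc (suc k))) * I) ≡ - bCoef (suc (suc k))
    cancel = ≡.trans (≡.sym (ℚₚ.neg-distribʳ-* 2ℚ (½ * (N * bCoef (suc (suc k))) * I)))
             (≡.cong -_ (≡.trans (regroup 2ℚ ½ N (bCoef (suc (suc k))) I)
                       (≡.trans (≡.cong (λ z → bCoef (suc (suc k)) * (1ℚ * z)) (!*inv! (suc (suc k))))
                                (ℚₚ.*-identityʳ (bCoef (suc (suc k)))))))

module BernoulliSeries where

  open import Data.Rational using (½; _+_; _*_; -_)
  import Data.Rational.Properties as ℚₚ
  open SeriesRing using (commutativeRing)
  open Scalars
  open Order
  open Substitution
  open BernoulliCoefficients
  open CommutativeRing commutativeRing using (setoid; sym; trans; +-cong; +-congʳ; -‿cong)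
  open import Relation.Binary.Reasoning.Setoid setoid

  Aₛ Tₛ : Series → Series
  Aₛ x = subst₁ aCoef x
  Tₛ x = subst₁ bCoef x

  expₛ≈1+x⊛A : ∀ x → Ord≥ 1 x → expₛ x ≈ₛ oneₛ ⊕ x ⊛ Aₛ x
  expₛ≈1+x⊛A x x∈𝔪 = begin
    expₛ x                                       ≈⟨ subst₁-cong x split ⟩
    subst₁ (λ n → δ₀ n + shift aCoef n) x        ≈⟨ subst₁-+ δ₀ (shift aCoef) x ⟩
    subst₁ δ₀ x ⊕ subst₁ (shift aCoef) x         ≈⟨ +-cong (subst₁-δ₀ x) (sym (⊛-subst₁ aCoef x x∈𝔪)) ⟩
    oneₛ ⊕ x ⊛ Aₛ x                              ∎
    where
    split : ∀ n → inv! n ≡ δ₀ n + shift aCoef n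
    split zero    = ≡.refl
    split (suc n) = ≡.sym (ℚₚ.+-identityˡ (aCoef n))

  A⊛T≈1 : ∀ x → Ord≥ 1 x → Aₛ x ⊛ Tₛ x ≈ₛ oneₛ
  A⊛T≈1 x x∈𝔪 = begin
    Aₛ x ⊛ Tₛ x              ≈⟨ subst₁-⊛ aCoef bCoef x x∈𝔪 ⟩
    subst₁ (aCoef ∗ bCoef) x ≈⟨ subst₁-cong x aCoef∗bCoef ⟩
    subst₁ δ₀ x              ≈⟨ subst₁-δ₀ x ⟩
    oneₛ                     ∎

  x⊛2β : ∀ x → Ord≥ 1 x → x ⊛ (2ℚ ·ₛ βₛ x) ≈ₛ oneₛ ⊖ ½ ·ₛ x ⊖ Tₛ x
  x⊛2β x x∈𝔪 = begin
    x ⊛ (2ℚ ·ₛ βₛ x)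
      ≈⟨ ⊛-·ₛ 2ℚ x (βₛ x) ⟩
    2ℚ ·ₛ (x ⊛ βₛ x)
      ≈⟨ ·ₛ-cong 2ℚ (⊛-subst₁ βCoef x x∈𝔪) ⟩
    2ℚ ·ₛ subst₁ (shift βCoef) x
      ≈⟨ subst₁-·ₛ 2ℚ (shift βCoef) x ⟨
    subst₁ (λ n → 2ℚ * shift βCoef n) x
      ≈⟨ subst₁-cong x 2β-coeff ⟩
    subst₁ (λ n → δ₀ n + - (½ * δ₁ n) + - bCoef n) x
      ≈⟨ subst₁-+ (λ n → δ₀ n + - (½ * δ₁ n)) (λ n → - bCoef n) x ⟩
    subst₁ (λ n → δ₀ n + - (½ * δ₁ n)) x ⊕ subst₁ (λ n → - bCoef n) x
      ≈⟨ +-cong (subst₁-+ δ₀ (λ n → - (½ * δ₁ n)) x) (subst₁-neg bCoef x) ⟩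
    subst₁ δ₀ x ⊕ subst₁ (λ n → - (½ * δ₁ n)) x ⊖ Tₛ x
      ≈⟨ +-congʳ (+-cong (subst₁-δ₀ x) (trans (subst₁-neg (λ n → ½ * δ₁ n) x)
                                               (-‿cong (trans (subst₁-·ₛ ½ δ₁ x) (·ₛ-cong ½ (subst₁-δ₁ x x∈𝔪)))))) ⟩
    oneₛ ⊖ ½ ·ₛ x ⊖ Tₛ x
      ∎

module SeriesSolver where

  open import Data.Maybe using (Maybe; just; nothing)
  open import Data.Rational as ℚ using (ℚ; 0ℚ; 1ℚ; _≟_)
  import Data.Rational.Properties as ℚₚ
  open import Algebra.Solver.Ring.AlmostCommutativeRing
    using (AlmostCommutativeRing; fromCommutativeRing; _-Raw-AlmostCommutative⟶_; Induced-equivalence)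
  open SeriesRing using (commutativeRing)
  open Scalars using (·ₛ-⊛; ·ₛ-cong; ·ₛ-assoc)
  open CommutativeRing commutativeRing using (0#; refl; sym; trans; +-cong; *-cong; -‿cong; *-identityˡ)

  constₛ≈·ₛ : ∀ r → constₛ r ≈ₛ r ·ₛ oneₛ
  constₛ≈·ₛ r j a b c d = regroup r (ind (isZero j)) (ind (isZero a)) (ind (isZero b)) (ind (isZero c)) (ind (isZero d))
    where
    open import Data.Rational.Solver using (module +-*-Solver)
    open +-*-Solver using (solve; _:=_; _:*_; con)
    regroup : ∀ r i₁ i₂ i₃ i₄ i₅ → r ℚ.* i₁ ℚ.* i₂ ℚ.* i₃ ℚ.* i₄ ℚ.* i₅ ≡ r ℚ.* (1ℚ ℚ.* i₁ ℚ.* i₂ ℚ.* i₃ ℚ.* i₄ ℚ.* i₅)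
    regroup = solve 6 (λ r i₁ i₂ i₃ i₄ i₅ →
                r :* i₁ :* i₂ :* i₃ :* i₄ :* i₅ := r :* (con 1ℚ :* i₁ :* i₂ :* i₃ :* i₄ :* i₅)) ≡.refl

  constₛ-0 : constₛ 0ℚ ≈ₛ 0#
  constₛ-0 = trans (constₛ≈·ₛ 0ℚ) (λ j a b c d → ℚₚ.*-zeroˡ (oneₛ j a b c d))

  ·ₛ≈constₛ⊛ : ∀ r F → r ·ₛ F ≈ₛ constₛ r ⊛ F
  ·ₛ≈constₛ⊛ r F = sym (trans (*-cong (constₛ≈·ₛ r) (refl {F})) (trans (·ₛ-⊛ r oneₛ F) (·ₛ-cong r (*-identityˡ F))))

  constₛ-morphism : CommutativeRing.rawRing ℚₚ.+-*-commutativeRing -Raw-AlmostCommutative⟶ fromCommutativeRing commutativeRing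
  constₛ-morphism = record
    { ⟦_⟧    = constₛ
    ; +-homo = λ r s → trans (constₛ≈·ₛ (r ℚ.+ s))
                       (trans (λ j a b c d → ℚₚ.*-distribʳ-+ (oneₛ j a b c d) r s) (sym (+-cong (constₛ≈·ₛ r) (constₛ≈·ₛ s))))
    ; *-homo = λ r s → trans (constₛ≈·ₛ (r ℚ.* s)) (trans (sym (·ₛ-assoc r s oneₛ))
                       (trans (·ₛ-cong r (sym (constₛ≈·ₛ s))) (·ₛ≈constₛ⊛ r (constₛ s))))
    ; -‿homo = λ r → trans (constₛ≈·ₛ (ℚ.- r))
                     (trans (λ j a b c d → ≡.sym (ℚₚ.neg-distribˡ-* r (oneₛ j a b c d))) (-‿cong (sym (constₛ≈·ₛ r))))
    ; 0-homo = constₛ-0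
    ; 1-homo = refl
    }

  constₛ-≟ : ∀ r s → Maybe (Induced-equivalence constₛ-morphism r s)
  constₛ-≟ r s with r ≟ s
  ... | yes ≡.refl = just refl
  ... | no  _      = nothing

  open import Algebra.Solver.Ring (CommutativeRing.rawRing ℚₚ.+-*-commutativeRing) (fromCommutativeRing commutativeRing)
                                  constₛ-morphism constₛ-≟ public

module Geometric where

  open import Data.Rational as ℚ using (0ℚ; 1ℚ)
  import Data.Rational.Properties as ℚₚ
  open SeriesRing using (commutativeRing)
  open Order
  open SeriesSolver
  open CommutativeRing commutativeRing using (setoid; refl; +-congʳ; distribʳ)
  open FiniteSum commutativeRing using (Σ; Σ-cong)

  geometric-partial : ∀ U D → Σ D (U ^ₛ_) ⊛ (oneₛ ⊖ U) ≈ₛ oneₛ ⊖ U ^ₛ suc D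
  geometric-partial U zero = solve 1 (λ U → con 1ℚ :* (con 1ℚ :- U) := con 1ℚ :- U :* con 1ℚ) refl U
  geometric-partial U (suc D) = begin
    (Σ D (U ^ₛ_) ⊕ Uᴰ⁺¹) ⊛ (oneₛ ⊖ U)             ≈⟨ distribʳ (oneₛ ⊖ U) (Σ D (U ^ₛ_)) Uᴰ⁺¹ ⟩
    Σ D (U ^ₛ_) ⊛ (oneₛ ⊖ U) ⊕ Uᴰ⁺¹ ⊛ (oneₛ ⊖ U) ≈⟨ +-congʳ {Uᴰ⁺¹ ⊛ (oneₛ ⊖ U)} (geometric-partial U D) ⟩
    (oneₛ ⊖ Uᴰ⁺¹) ⊕ Uᴰ⁺¹ ⊛ (oneₛ ⊖ U)           ≈⟨ telescope U Uᴰ⁺¹ ⟩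
    oneₛ ⊖ U ^ₛ suc (suc D)                      ∎
    where
    open import Relation.Binary.Reasoning.Setoid setoid
    Uᴰ⁺¹ = U ^ₛ suc D
    telescope : ∀ U P → (oneₛ ⊖ P) ⊕ P ⊛ (oneₛ ⊖ U) ≈ₛ oneₛ ⊖ U ⊛ P
    telescope = solve 2 (λ U P → (con 1ℚ :- P) :+ P :* (con 1ℚ :- U) := con 1ℚ :- U :* P) refl

  inv1-ₛ-⊛ : ∀ U → Ord≥ 1 U → inv1-ₛ U ⊛ (oneₛ ⊖ U) ≈ₛ oneₛ
  inv1-ₛ-⊛ U U∈𝔪 j a b c d = begin
    (inv1-ₛ U ⊛ (oneₛ ⊖ U)) j a b c d
      ≡⟨ ⊛-cong-≤degree D {G = oneₛ ⊖ U} truncate (λ _ _ _ _ _ _ → ≡.refl) j a b c d ℕₚ.≤-refl ⟩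
    (Σ D (U ^ₛ_) ⊛ (oneₛ ⊖ U)) j a b c d
      ≡⟨ geometric-partial U D j a b c d ⟩
    oneₛ j a b c d ℚ.+ ℚ.- (U ^ₛ suc D) j a b c d
      ≡⟨ ≡.cong (λ z → oneₛ j a b c d ℚ.+ ℚ.- z) (Ord≥-^ U U∈𝔪 (suc D) j a b c d ℕₚ.≤-refl) ⟩
    oneₛ j a b c d ℚ.+ ℚ.- 0ℚ
      ≡⟨ ℚₚ.+-identityʳ (oneₛ j a b c d) ⟩
    oneₛ j a b c d
      ∎
    where
    open ≡.≡-Reasoning
    D = degree j a b c d
    truncate : ∀ j a b c d → degree j a b c d ≤ D → inv1-ₛ U j a b c d ≡ Σ D (U ^ₛ_) j a b c d
    truncate j a b c d deg≤D =
      ≡.trans (Σ∞-truncate (λ n → 1ℚ ·ₛ (U ^ₛ n)) (subst₁-summable (λ _ → 1ℚ) U U∈𝔪) D j a b c d deg≤D)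
              (Σ-cong D (λ n j a b c d → ℚₚ.*-identityˡ ((U ^ₛ n) j a b c d)) j a b c d)
      where open Substitution using (subst₁-summable)

module DividedDifference where

  open import Data.Rational as ℚ using (_-_)
  import Data.Rational.Properties as ℚₚ
  open SeriesRing using (commutativeRing; Σ≤-cong; X₁-⊛-suc; X₂-⊛-suc; X₂-⊛-zero)
  open RationalSums using (Σ≤-telescope-to)
  open CommutativeRing commutativeRing using (0#; sym; trans; +-congˡ; distribʳ)
  open import Algebra.Properties.Ring (CommutativeRing.ring commutativeRing) using (-‿distribˡ-*)

  divX₁-X₂-cong : ∀ {H H′} → H ≈ₛ H′ → divX₁-X₂ H ≈ₛ divX₁-X₂ H′
  divX₁-X₂-cong H≈H′ j a b c d = Σ≤-cong b (λ i → H≈H′ j (a ℕ.+ 1 ℕ.+ i) (b ∸ i) c d)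

  X₁⊖X₂-⊛ : ∀ G → (X₁ ⊖ X₂) ⊛ G ≈ₛ X₁ ⊛ G ⊖ X₂ ⊛ G
  X₁⊖X₂-⊛ G = trans (distribʳ G X₁ (⊝ X₂)) (+-congˡ {X₁ ⊛ G} (sym (-‿distribˡ-* X₂ G)))

  divX₁-X₂-⊛ : ∀ G → divX₁-X₂ ((X₁ ⊖ X₂) ⊛ G) ≈ₛ G
  divX₁-X₂-⊛ G j a b c d =
    ≡.trans (Σ≤-telescope-to b g e difference last) (≡.cong (λ a′ → G j a′ b c d) (ℕₚ.+-identityʳ a))
    where
    g e : ℕ → ℚ.ℚ
    g i = G j (a ℕ.+ i) (b ∸ i) c d
    e i = ((X₁ ⊖ X₂) ⊛ G) j (a ℕ.+ 1 ℕ.+ i) (b ∸ i) c d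
    a+1+i : ∀ i → a ℕ.+ 1 ℕ.+ i ≡ suc (a ℕ.+ i)
    a+1+i i = ≡.trans (ℕₚ.+-assoc a 1 i) (ℕₚ.+-suc a i)
    split : ∀ i → e i ≡ g i - (X₂ ⊛ G) j (suc (a ℕ.+ i)) (b ∸ i) c d
    split i rewrite a+1+i i = ≡.trans (X₁⊖X₂-⊛ G j (suc (a ℕ.+ i)) (b ∸ i) c d)
                                      (≡.cong (_- (X₂ ⊛ G) j (suc (a ℕ.+ i)) (b ∸ i) c d) (X₁-⊛-suc G j (a ℕ.+ i) (b ∸ i) c d))
    difference : ∀ i → i < b → e i ≡ g i - g (suc i)
    difference i i<b = ≡.trans (split i) (≡.cong (g i -_) shifted)
      where
      shifted : (X₂ ⊛ G) j (suc (a ℕ.+ i)) (b ∸ i) c d ≡ g (suc i)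
      shifted rewrite ℕₚ.+-∸-assoc 1 i<b | ℕₚ.+-suc a i = X₂-⊛-suc G j (suc (a ℕ.+ i)) (b ∸ suc i) c d
    last : e b ≡ g b
    last = ≡.trans (split b) (≡.trans (≡.cong (λ k → g b - (X₂ ⊛ G) j (suc (a ℕ.+ b)) k c d) (ℕₚ.n∸n≡0 b))
                                      (≡.trans (≡.cong (g b -_) (X₂-⊛-zero G j (suc (a ℕ.+ b)) c d)) (ℚₚ.+-identityʳ (g b))))

  X₁⊖X₂-cancel : ∀ G → (X₁ ⊖ X₂) ⊛ G ≈ₛ 0# → G ≈ₛ 0#
  X₁⊖X₂-cancel G t⊛G≈0 =
    trans (sym (divX₁-X₂-⊛ G)) (trans (divX₁-X₂-cong t⊛G≈0) (λ j a b c d → RationalSums.Σ≤-zero b (λ _ _ → ≡.refl)))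

-- Each identity below holds modulo a list of relations rᵢ ≈ 0: the ring solver verifies
-- lhs = rhs + Σ cᵢ rᵢ for an explicit choice of multipliers cᵢ, and the relations kill the sum.
module RingIdentities where

  open import Data.Rational using (1ℚ; ½)
  open SeriesRing using (commutativeRing)
  open SeriesSolver
  open CommutativeRing commutativeRing
    using (0#; refl; sym; trans; +-cong; +-congˡ; *-congˡ; -‿cong; -‿inverseʳ; +-identityʳ; zeroʳ)
  open import Algebra.Properties.Ring (CommutativeRing.ring commutativeRing) using (-0#≈0#)

  ½ₛ : Series
  ½ₛ = constₛ ½

  ≈⇒⊖≈0 : ∀ {x y} → x ≈ₛ y → x ⊖ y ≈ₛ 0#
  ≈⇒⊖≈0 {x} x≈y = trans (+-congˡ {x} (-‿cong (sym x≈y))) (-‿inverseʳ x)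

  ⊛-0 : ∀ c {r} → r ≈ₛ 0# → c ⊛ r ≈ₛ 0#
  ⊛-0 c r≈0 = trans (*-congˡ {c} r≈0) (zeroʳ c)

  ⊕-0 : ∀ {r r′} → r ≈ₛ 0# → r′ ≈ₛ 0# → r ⊕ r′ ≈ₛ 0#
  ⊕-0 r≈0 r′≈0 = trans (+-cong r≈0 r′≈0) (+-identityʳ 0#)

  ⊖-0 : ∀ {r r′} → r ≈ₛ 0# → r′ ≈ₛ 0# → r ⊖ r′ ≈ₛ 0#
  ⊖-0 r≈0 r′≈0 = trans (+-cong r≈0 (trans (-‿cong r′≈0) -0#≈0#)) (+-identityʳ 0#)

  modulo : ∀ {x y} k → x ≈ₛ y ⊕ k → k ≈ₛ 0# → x ≈ₛ y
  modulo {y = y} k x≈y+k k≈0 = trans x≈y+k (trans (+-congˡ {y} k≈0) (+-identityʳ y))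

  private
    c1 c½ : ∀ {n} → Polynomial n
    c1 = con 1ℚ
    c½ = con ½
    geometric-relation : ∀ {n} → Polynomial n → Polynomial n → Polynomial n → Polynomial n
    geometric-relation I u E = I :* (c1 :- u :* E) :- c1

  L-difference : ∀ u E₁ E₂ W I₁ I₂ e t A →
    I₁ ⊛ (oneₛ ⊖ u ⊛ E₁) ≈ₛ oneₛ → I₂ ⊛ (oneₛ ⊖ u ⊛ E₂) ≈ₛ oneₛ → E₁ ≈ₛ E₂ ⊛ e → e ≈ₛ oneₛ ⊕ t ⊛ A →
    u ⊛ (E₁ ⊛ W) ⊛ I₁ ⊖ u ⊛ (E₂ ⊛ W) ⊛ I₂ ≈ₛ t ⊛ (u ⊛ W ⊛ I₁ ⊛ I₂ ⊛ E₂ ⊛ A)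
  L-difference u E₁ E₂ W I₁ I₂ e t A geo₁ geo₂ E₁≈E₂e e≈1+tA = modulo _
    (solve 9 (λ u E₁ E₂ W I₁ I₂ e t A →
       u :* (E₁ :* W) :* I₁ :- u :* (E₂ :* W) :* I₂ :=
       t :* (u :* W :* I₁ :* I₂ :* E₂ :* A)
       :+ ((u :* W :* I₁ :* I₂) :* (E₁ :- E₂ :* e)
           :+ (u :* W :* I₁ :* I₂ :* E₂) :* (e :- (c1 :+ t :* A))
           :- (u :* W :* E₁ :* I₁) :* geometric-relation I₂ u E₂
           :+ (u :* W :* E₂ :* I₂) :* geometric-relation I₁ u E₁))
      refl u E₁ E₂ W I₁ I₂ e t A)
    (⊕-0 (⊖-0 (⊕-0 (⊛-0 (u ⊛ W ⊛ I₁ ⊛ I₂) (≈⇒⊖≈0 E₁≈E₂e))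
                    (⊛-0 (u ⊛ W ⊛ I₁ ⊛ I₂ ⊛ E₂) (≈⇒⊖≈0 e≈1+tA)))
              (⊛-0 (u ⊛ W ⊛ E₁ ⊛ I₁) (≈⇒⊖≈0 geo₂)))
         (⊛-0 (u ⊛ W ⊛ E₂ ⊛ I₂) (≈⇒⊖≈0 geo₁)))

  product-formula : ∀ u E₁ E₂ W W₁ W₂ I₁ I₂ e t A T P Q →
    I₁ ⊛ (oneₛ ⊖ u ⊛ E₁) ≈ₛ oneₛ → I₂ ⊛ (oneₛ ⊖ u ⊛ E₂) ≈ₛ oneₛ → E₁ ≈ₛ E₂ ⊛ e → e ≈ₛ oneₛ ⊕ t ⊛ A →
    A ⊛ T ≈ₛ oneₛ → t ⊛ P ≈ₛ oneₛ ⊖ ½ₛ ⊛ t ⊖ T → P ⊕ Q ≈ₛ 0# → W ≈ₛ W₁ ⊛ W₂ →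
    u ⊛ W ⊛ I₁ ⊛ I₂ ⊛ E₂ ⊛ A ⊕ (Q ⊖ ½ₛ) ⊛ (u ⊛ (E₁ ⊛ W) ⊛ I₁) ⊕ (P ⊖ ½ₛ) ⊛ (u ⊛ (E₂ ⊛ W) ⊛ I₂)
      ≈ₛ (u ⊛ (E₁ ⊛ W₁) ⊛ I₁) ⊛ (u ⊛ (E₂ ⊛ W₂) ⊛ I₂)
  product-formula u E₁ E₂ W W₁ W₂ I₁ I₂ e t A T P Q geo₁ geo₂ E₁≈E₂e e≈1+tA A⊛T≈1 t⊛P≈ P+Q≈0 W≈W₁W₂ = modulo _
    (solve 14 (λ u E₁ E₂ W W₁ W₂ I₁ I₂ e t A T P Q →
       u :* W :* I₁ :* I₂ :* E₂ :* A :+ (Q :- c½) :* (u :* (E₁ :* W) :* I₁) :+ (P :- c½) :* (u :* (E₂ :* W) :* I₂) :=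
       (u :* (E₁ :* W₁) :* I₁) :* (u :* (E₂ :* W₂) :* I₂)
       :+ ((u :* W :* I₁ :* I₂ :* E₂) :* (A :* T :- c1)
           :- (u :* W :* I₁ :* I₂ :* E₂ :* A) :* (t :* P :- (c1 :- c½ :* t :- T))
           :- (u :* W :* I₁ :* I₂ :* E₂ :* (P :+ c½)) :* (e :- (c1 :+ t :* A))
           :- (u :* W :* I₁ :* I₂ :* (P :+ c½)) :* (E₁ :- E₂ :* e)
           :+ (u :* u :* E₁ :* E₂ :* I₁ :* I₂) :* (W :- W₁ :* W₂)
           :+ (u :* E₁ :* W :* I₁) :* (P :+ Q)
           :+ ((P :+ c½) :* u :* E₁ :* W :* I₁) :* geometric-relation I₂ u E₂
           :- ((P :- c½) :* u :* E₂ :* W :* I₂) :* geometric-relation I₁ u E₁))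
      refl u E₁ E₂ W W₁ W₂ I₁ I₂ e t A T P Q)
    (⊖-0 (⊕-0 (⊕-0 (⊕-0 (⊖-0 (⊖-0 (⊖-0
       (⊛-0 (u ⊛ W ⊛ I₁ ⊛ I₂ ⊛ E₂) (≈⇒⊖≈0 A⊛T≈1))
       (⊛-0 (u ⊛ W ⊛ I₁ ⊛ I₂ ⊛ E₂ ⊛ A) (≈⇒⊖≈0 t⊛P≈)))
       (⊛-0 (u ⊛ W ⊛ I₁ ⊛ I₂ ⊛ E₂ ⊛ (P ⊕ ½ₛ)) (≈⇒⊖≈0 e≈1+tA)))
       (⊛-0 (u ⊛ W ⊛ I₁ ⊛ I₂ ⊛ (P ⊕ ½ₛ)) (≈⇒⊖≈0 E₁≈E₂e)))
       (⊛-0 (u ⊛ u ⊛ E₁ ⊛ E₂ ⊛ I₁ ⊛ I₂) (≈⇒⊖≈0 W≈W₁W₂)))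
       (⊛-0 (u ⊛ E₁ ⊛ W ⊛ I₁) P+Q≈0))
       (⊛-0 ((P ⊕ ½ₛ) ⊛ u ⊛ E₁ ⊛ W ⊛ I₁) (≈⇒⊖≈0 geo₂)))
       (⊛-0 ((P ⊖ ½ₛ) ⊛ u ⊛ E₂ ⊛ W ⊛ I₂) (≈⇒⊖≈0 geo₁)))

  -- With s = -t one has t(P + Q) = Ts - T - t, and Ts - T = t because eᵗe⁻ᵗ = 1;
  -- the second factor t clears the denominators A and As.
  t²⊛[P+Q]≈0 : ∀ t s P Q A As T Ts e f →
    e ⊛ f ≈ₛ oneₛ → e ≈ₛ oneₛ ⊕ t ⊛ A → f ≈ₛ oneₛ ⊕ s ⊛ As → A ⊛ T ≈ₛ oneₛ → As ⊛ Ts ≈ₛ oneₛ →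
    t ⊛ P ≈ₛ oneₛ ⊖ ½ₛ ⊛ t ⊖ T → s ⊛ Q ≈ₛ oneₛ ⊖ ½ₛ ⊛ s ⊖ Ts → s ⊕ t ≈ₛ 0# →
    t ⊛ (t ⊛ (P ⊕ Q)) ≈ₛ 0#
  t²⊛[P+Q]≈0 t s P Q A As T Ts e f e⊛f≈1 e≈1+tA f≈1+sAs A⊛T≈1 As⊛Ts≈1 t⊛P≈ s⊛Q≈ s+t≈0 = trans
    (solve 10 (λ t s P Q A As T Ts e f →
       t :* (t :* (P :+ Q)) :=
       (T :* Ts) :* (e :* f :- c1)
           :- (T :* Ts :* (c1 :+ t :* A)) :* (As :* (s :+ t) :+ (f :- (c1 :+ s :* As)))
           :- (T :* Ts :* f) :* (e :- (c1 :+ t :* A))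
           :- (t :* Ts) :* (A :* T :- c1)
           :+ (t :* T) :* (As :* Ts :- c1)
           :+ (t :* t) :* ((A :* T :- c1) :+ (As :* Ts :- c1) :+ (A :* T :- c1) :* (As :* Ts :- c1))
           :+ t :* (t :* P :- (c1 :- c½ :* t :- T))
           :- t :* (s :* Q :- (c1 :- c½ :* s :- Ts))
           :+ (t :* (c½ :+ Q)) :* (s :+ t))
      refl t s P Q A As T Ts e f)
    (⊕-0 (⊖-0 (⊕-0 (⊕-0 (⊕-0 (⊖-0 (⊖-0 (⊖-0
       (⊛-0 (T ⊛ Ts) (≈⇒⊖≈0 e⊛f≈1))
       (⊛-0 (T ⊛ Ts ⊛ (oneₛ ⊕ t ⊛ A)) (⊕-0 (⊛-0 As s+t≈0) (≈⇒⊖≈0 f≈1+sAs))))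
       (⊛-0 (T ⊛ Ts ⊛ f) (≈⇒⊖≈0 e≈1+tA)))
       (⊛-0 (t ⊛ Ts) (≈⇒⊖≈0 A⊛T≈1)))
       (⊛-0 (t ⊛ T) (≈⇒⊖≈0 As⊛Ts≈1)))
       (⊛-0 (t ⊛ t) (⊕-0 (⊕-0 (≈⇒⊖≈0 A⊛T≈1) (≈⇒⊖≈0 As⊛Ts≈1)) (⊛-0 (A ⊛ T ⊖ oneₛ) (≈⇒⊖≈0 As⊛Ts≈1)))))
       (⊛-0 t (≈⇒⊖≈0 t⊛P≈)))
       (⊛-0 t (≈⇒⊖≈0 s⊛Q≈)))
       (⊛-0 (t ⊛ (½ₛ ⊕ Q)) s+t≈0))

module Fixed-m (m : ℕ) (1≤m : 1 ≤ m) where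

  open import Data.Rational using (0ℚ; ½)
  import Data.Rational.Properties as ℚₚ
  open SeriesRing using (commutativeRing)
  open Order
  open Exponential using (expₛ-⊕; expₛ-0)
  open Substitution using (subst₁-congʳ)
  open BernoulliSeries
  open Geometric using (inv1-ₛ-⊛)
  open DividedDifference using (divX₁-X₂-cong; divX₁-X₂-⊛; X₁⊖X₂-cancel)
  open SeriesSolver using (constₛ-0; ·ₛ≈constₛ⊛; solve; _:=_; _:+_; _:-_; con)
  open RingIdentities
  open CommutativeRing commutativeRing using (0#; refl; sym; trans; +-cong; +-congˡ; +-congʳ; -‿cong; *-congˡ; *-congʳ)

  u t s Y₁₂ : Series
  u   = qᵛ ^ₛ m
  t   = X₁ ⊖ X₂
  s   = X₂ ⊖ X₁
  Y₁₂ = Y₁ ⊕ Y₂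

  m· I 2β : Series → Series
  m· Y = ℕ→ℚ m ·ₛ Y
  I E  = inv1-ₛ (u ⊛ E)
  2β x = 2ℚ ·ₛ βₛ x

  L′ : Series → Series → Series
  L′ X Y = u ⊛ (expₛ X ⊛ expₛ (m· Y)) ⊛ I (expₛ X)

  X₁∈𝔪 : Ord≥ 1 X₁
  X₁∈𝔪 = Ord≥1 X₁ ≡.refl

  X₂∈𝔪 : Ord≥ 1 X₂
  X₂∈𝔪 = Ord≥1 X₂ ≡.refl

  Y₁∈𝔪 : Ord≥ 1 Y₁
  Y₁∈𝔪 = Ord≥1 Y₁ ≡.refl

  Y₂∈𝔪 : Ord≥ 1 Y₂
  Y₂∈𝔪 = Ord≥1 Y₂ ≡.refl

  Y₁₂∈𝔪 : Ord≥ 1 Y₁₂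
  Y₁₂∈𝔪 = Ord≥-⊕ Y₁ Y₂ Y₁∈𝔪 Y₂∈𝔪

  u∈𝔪 : Ord≥ 1 u
  u∈𝔪 = Ord≥-mono u 1≤m (Ord≥-^ qᵛ (Ord≥1 qᵛ ≡.refl) m)

  t∈𝔪 : Ord≥ 1 t
  t∈𝔪 = Ord≥-⊕ X₁ (⊝ X₂) X₁∈𝔪 (Ord≥-⊝ X₂ X₂∈𝔪)

  s∈𝔪 : Ord≥ 1 s
  s∈𝔪 = Ord≥-⊕ X₂ (⊝ X₁) X₂∈𝔪 (Ord≥-⊝ X₁ X₁∈𝔪)

  t+s≈0 : t ⊕ s ≈ₛ 0#
  t+s≈0 = trans (solve 2 (λ x y → (x :- y) :+ (y :- x) := con 0ℚ) refl X₁ X₂) constₛ-0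

  s+t≈0 : s ⊕ t ≈ₛ 0#
  s+t≈0 = trans (solve 2 (λ x y → (y :- x) :+ (x :- y) := con 0ℚ) refl X₁ X₂) constₛ-0

  m·∈𝔪 : ∀ {Y} → Ord≥ 1 Y → Ord≥ 1 (m· Y)
  m·∈𝔪 {Y} = Ord≥-·ₛ (ℕ→ℚ m) Y

  L≈L′ : ∀ {X Y} → Ord≥ 1 X → Ord≥ 1 Y → L m X Y ≈ₛ L′ X Y
  L≈L′ {X} {Y} X∈𝔪 Y∈𝔪 = *-congʳ {I (expₛ X)} (*-congˡ {u} (expₛ-⊕ X (m· Y) X∈𝔪 (m·∈𝔪 Y∈𝔪)))

  I-inverse : ∀ E → I E ⊛ (oneₛ ⊖ u ⊛ E) ≈ₛ oneₛ
  I-inverse E = inv1-ₛ-⊛ (u ⊛ E) (Ord≥-⊛ u E u∈𝔪 (λ _ _ _ _ _ ()))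

  expX₁≈expX₂⊛expt : expₛ X₁ ≈ₛ expₛ X₂ ⊛ expₛ t
  expX₁≈expX₂⊛expt = trans (subst₁-congʳ inv! X₁≈X₂+t) (expₛ-⊕ X₂ t X₂∈𝔪 t∈𝔪)
    where
    X₁≈X₂+t : X₁ ≈ₛ X₂ ⊕ t
    X₁≈X₂+t = solve 2 (λ x y → x := y :+ (x :- y)) refl X₁ X₂

  expt⊛exps≈1 : expₛ t ⊛ expₛ s ≈ₛ oneₛ
  expt⊛exps≈1 = trans (sym (expₛ-⊕ t s t∈𝔪 s∈𝔪)) (expₛ-0 t+s≈0)

  expm·Y₁₂≈ : expₛ (m· Y₁₂) ≈ₛ expₛ (m· Y₁) ⊛ expₛ (m· Y₂)
  expm·Y₁₂≈ = trans (subst₁-congʳ inv! (λ j a b c d → ℚₚ.*-distribˡ-+ (ℕ→ℚ m) (Y₁ j a b c d) (Y₂ j a b c d)))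
                    (expₛ-⊕ (m· Y₁) (m· Y₂) (m·∈𝔪 Y₁∈𝔪) (m·∈𝔪 Y₂∈𝔪))

  x⊛2β≈ : ∀ x → Ord≥ 1 x → x ⊛ 2β x ≈ₛ oneₛ ⊖ ½ₛ ⊛ x ⊖ Tₛ x
  x⊛2β≈ x x∈𝔪 = trans (x⊛2β x x∈𝔪) (+-congʳ {⊝ Tₛ x} (+-congˡ {oneₛ} (-‿cong (·ₛ≈constₛ⊛ ½ x))))

  β-odd : 2β t ⊕ 2β s ≈ₛ 0#
  β-odd = X₁⊖X₂-cancel _ (X₁⊖X₂-cancel _ t²[P+Q]≈0)
    where
    t²[P+Q]≈0 : t ⊛ (t ⊛ (2β t ⊕ 2β s)) ≈ₛ 0#
    t²[P+Q]≈0 = t²⊛[P+Q]≈0 t s (2β t) (2β s) (Aₛ t) (Aₛ s) (Tₛ t) (Tₛ s) (expₛ t) (expₛ s)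
      expt⊛exps≈1 (expₛ≈1+x⊛A t t∈𝔪) (expₛ≈1+x⊛A s s∈𝔪) (A⊛T≈1 t t∈𝔪) (A⊛T≈1 s s∈𝔪)
      (x⊛2β≈ t t∈𝔪) (x⊛2β≈ s s∈𝔪) s+t≈0

  ΔL : Series
  ΔL = u ⊛ expₛ (m· Y₁₂) ⊛ I (expₛ X₁) ⊛ I (expₛ X₂) ⊛ expₛ X₂ ⊛ Aₛ t

  divided-difference : divX₁-X₂ (L m X₁ Y₁₂ ⊖ L m X₂ Y₁₂) ≈ₛ ΔL
  divided-difference = trans (divX₁-X₂-cong (trans (+-cong (L≈L′ X₁∈𝔪 Y₁₂∈𝔪) (-‿cong (L≈L′ X₂∈𝔪 Y₁₂∈𝔪))) L′-difference))
                             (divX₁-X₂-⊛ ΔL)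
    where
    L′-difference : L′ X₁ Y₁₂ ⊖ L′ X₂ Y₁₂ ≈ₛ t ⊛ ΔL
    L′-difference = L-difference u (expₛ X₁) (expₛ X₂) (expₛ (m· Y₁₂)) (I (expₛ X₁)) (I (expₛ X₂)) (expₛ t) t (Aₛ t)
                                 (I-inverse (expₛ X₁)) (I-inverse (expₛ X₂)) expX₁≈expX₂⊛expt (expₛ≈1+x⊛A t t∈𝔪)

  L′-product : ΔL ⊕ (2β s ⊖ ½ₛ) ⊛ L′ X₁ Y₁₂ ⊕ (2β t ⊖ ½ₛ) ⊛ L′ X₂ Y₁₂ ≈ₛ L′ X₁ Y₁ ⊛ L′ X₂ Y₂
  L′-product =
    product-formula u (expₛ X₁) (expₛ X₂) (expₛ (m· Y₁₂)) (expₛ (m· Y₁)) (expₛ (m· Y₂)) (I (expₛ X₁)) (I (expₛ X₂))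
                    (expₛ t) t (Aₛ t) (Tₛ t) (2β t) (2β s)
                    (I-inverse (expₛ X₁)) (I-inverse (expₛ X₂)) expX₁≈expX₂⊛expt (expₛ≈1+x⊛A t t∈𝔪)
                    (A⊛T≈1 t t∈𝔪) (x⊛2β≈ t t∈𝔪) β-odd expm·Y₁₂≈

lemma5p3 : (m : ℕ) → 1 ≤ m →
    L m X₁ Y₁ ⊛ L m X₂ Y₂ ≈ₛ
      divX₁-X₂ (L m X₁ (Y₁ ⊕ Y₂) ⊖ L m X₂ (Y₁ ⊕ Y₂))
      ⊕ ((2ℚ ·ₛ βₛ (X₂ ⊖ X₁)) ⊖ constₛ ½) ⊛ L m X₁ (Y₁ ⊕ Y₂)
      ⊕ ((2ℚ ·ₛ βₛ (X₁ ⊖ X₂)) ⊖ constₛ ½) ⊛ L m X₂ (Y₁ ⊕ Y₂)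
lemma5p3 m 1≤m = sym (begin
  divX₁-X₂ (L m X₁ Y₁₂ ⊖ L m X₂ Y₁₂) ⊕ (2β s ⊖ constₛ ½) ⊛ L m X₁ Y₁₂ ⊕ (2β t ⊖ constₛ ½) ⊛ L m X₂ Y₁₂
    ≈⟨ +-cong (+-cong divided-difference (*-congˡ {2β s ⊖ constₛ ½} (L≈L′ X₁∈𝔪 Y₁₂∈𝔪)))
               (*-congˡ {2β t ⊖ constₛ ½} (L≈L′ X₂∈𝔪 Y₁₂∈𝔪)) ⟩
  ΔL ⊕ (2β s ⊖ constₛ ½) ⊛ L′ X₁ Y₁₂ ⊕ (2β t ⊖ constₛ ½) ⊛ L′ X₂ Y₁₂
    ≈⟨ L′-product ⟩
  L′ X₁ Y₁ ⊛ L′ X₂ Y₂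
    ≈⟨ *-cong (L≈L′ X₁∈𝔪 Y₁∈𝔪) (L≈L′ X₂∈𝔪 Y₂∈𝔪) ⟨
  L m X₁ Y₁ ⊛ L m X₂ Y₂
    ∎)
  where
  open Fixed-m m 1≤m
  open CommutativeRing SeriesRing.commutativeRing using (setoid; sym; +-cong; *-cong; *-congˡ)
  open import Relation.Binary.Reasoning.Setoid setoid
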